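{- Let $k\geq 1$, let $P_{2k}$ be the path with $2k$ vertices and let $H$ be a graph. Then the lexicographic product $P_{2k}[H]$ is hamiltonian connected if and only if $\pi(H)\geq 1$ in the case $k=1$, and $\pi(H)\geq 2$ in the case $k>1$.
   Context: The lexicographic product $G[H]$ has vertex set $V(G)\times V(H)$, with $(g,h)(g',h')$ an edge iff $gg'\in E(G)$, or $g=g'$ and $hh'\in E(H)$. $\pi(H)$ is the maximum number of edges of a spanning linear forest of $H$ (a forest whose components are paths). A graph is hamiltonian connected if every two vertices are joined by a hamiltonian path. -}

module Defs where

open import Data.Nat using (ℕ; zero; suc; _+_; _∸_; _*_)
open import Data.Fin using (Fin; toℕ)
open import Data.Product using (_×_; _,_; Σ; ∃)
open import Data.Sum using (_⊎_)
open import Data.List using (List; []; _∷_; length; concat; map; head; last)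
open import Data.Nat.ListAction using (sum)
open import Data.List.Relation.Unary.All using (All)
open import Data.List.Relation.Unary.Unique.Propositional using (Unique)
open import Data.List.Membership.Propositional using (_∈_)
open import Data.Maybe using (just)
open import Relation.Binary.PropositionalEquality using (_≡_)
open import Relation.Nullary using (¬_)


record Graph (V : Set) : Set₁ where
  field
    Adj   : V → V → Set
    sym   : ∀ {x y} → Adj x y → Adj y x
    irrefl : ∀ {x} → ¬ Adj x x
open Graph public

Walk : {V : Set} → (V → V → Set) → List V → Set
Walk A []             = Data.Unit.⊤ where import Data.Unit
Walk A (x ∷ [])       = Data.Unit.⊤ where import Data.Unit
Walk A (x ∷ y ∷ xs)   = A x y × Walk A (y ∷ xs)

IsPath : {V : Set} → Graph V → List V → Set
IsPath G p = (¬ p ≡ []) × Walk (Adj G) p × Unique p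

HamPath : {V : Set} → Graph V → V → V → List V → Set
HamPath G u v p = IsPath G p × (∀ x → x ∈ p) × head p ≡ just u × last p ≡ just v

HamiltonianConnected : {V : Set} → Graph V → Set
HamiltonianConnected G = ∀ u v → ¬ u ≡ v → ∃ λ p → HamPath G u v p

SpanningLinearForest : {V : Set} → Graph V → List (List V) → Set
SpanningLinearForest G ps =
  All (IsPath G) ps × Unique (concat ps) × (∀ x → x ∈ concat ps)

forestEdges : {V : Set} → List (List V) → ℕ
forestEdges ps = sum (map (λ p → length p ∸ 1) ps)

-- π(G) ≥ m : the maximum number of edges of a spanning linear forest is at least m,
-- i.e. some spanning linear forest has at least m edges.
πAtLeast : {V : Set} → Graph V → ℕ → Set
πAtLeast G m = ∃ λ ps → SpanningLinearForest G ps × m Data.Nat.≤ forestEdges ps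
  where import Data.Nat

pathGraph : (m : ℕ) → Graph (Fin m)
pathGraph m = record
  { Adj = λ i j → suc (toℕ i) ≡ toℕ j ⊎ suc (toℕ j) ≡ toℕ i
  ; sym = λ { (Data.Sum.inj₁ e) → Data.Sum.inj₂ e ; (Data.Sum.inj₂ e) → Data.Sum.inj₁ e }
  ; irrefl = λ { (Data.Sum.inj₁ e) → 1+n≢n e
               ; (Data.Sum.inj₂ e) → 1+n≢n e }
  }
  where
  import Data.Sum
  import Relation.Binary.PropositionalEquality
  open import Data.Nat.Properties using (1+n≢n)

lex : {A B : Set} → Graph A → Graph B → Graph (A × B)
lex G H = record
  { Adj = λ { (g , h) (g' , h') → Adj G g g' ⊎ (g ≡ g' × Adj H h h') }
  ; sym = λ { (Data.Sum.inj₁ e) → Data.Sum.inj₁ (Graph.sym G e)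
            ; (Data.Sum.inj₂ (Relation.Binary.PropositionalEquality.refl , e)) →
                Data.Sum.inj₂ (Relation.Binary.PropositionalEquality.refl , Graph.sym H e) }
  ; irrefl = λ { (Data.Sum.inj₁ e) → Graph.irrefl G e
               ; (Data.Sum.inj₂ (_ , e)) → Graph.irrefl H e }
  }
  where
  import Data.Sum
  import Relation.Binary.PropositionalEquality

module Submission where

-- Necessity. Weight the layers of P_m[H] by 0, 2, 1, 1, …. Every step xy of a walk satisfies
-- 2 + c ≤ w x + w y + 2 b, where b = 1 for a step inside layer 0 and c = 1 for a step between
-- layers 1 and 2. Layers 0 and 1 both contain n vertices, so the weights of all vertices add up to
-- their number, and summing over a hamiltonian path between two vertices of layer 1 gives
-- 2 + C ≤ 2 E. The E steps inside layer 0 are the edges of the runs of the path in layer 0, a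
-- spanning linear forest of H; if m ≥ 3 the path must reach layer 2, so C ≥ 1 and E ≥ 2.
--
-- Sufficiency. Cut P_2k[H] into k blocks of two consecutive layers, each a copy of K₂[H], and show
-- by induction that every window of consecutive blocks is hamiltonian connected. Endpoints in
-- different blocks are joined by cutting the window between them and linking a hamiltonian path of
-- each part. Endpoints in one block are joined by explicit zigzags through that block which leave it
-- once or twice for a detour spanning the rest of the window. Edges of H are used exactly where a
-- zigzag must move inside a layer: one edge always suffices except for a block at the end of the
-- window with both endpoints in its layer facing the detour, which needs a path of length two or
-- two disjoint edges.

open import Defs hiding (sym)
open import Data.Bool using (Bool; true; false; not; if_then_else_)
open import Data.Empty using (⊥-elim)
open import Data.Fin as Fin using (Fin; toℕ; fromℕ<)
open import Data.Fin.Properties using (toℕ-injective; toℕ-fromℕ<; toℕ<n)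
open import Data.List using (List; []; _∷_; length; _++_; map; filter; concat; allFin; last)
open import Data.List.Membership.Propositional using (_∈_; _∉_)
open import Data.List.Membership.Propositional.Properties
  using (∈-++⁻; ∈-++⁺ˡ; ∈-++⁺ʳ; ∈-map⁺; ∈-map⁻; ∈-filter⁺; ∈-filter⁻; ∈-allFin)
open import Data.List.Membership.Propositional.Properties.WithK using (unique∧set⇒bag)
open import Data.List.Properties using (length-++; length-map; length-tabulate; map-++; filter-accept; filter-reject)
open import Data.List.Relation.Binary.BagAndSetEquality using (∼bag⇒↭)
open import Data.List.Relation.Binary.Permutation.Propositional using (_↭_; prep; ↭-refl; ↭-sym; ↭-trans; ↭⇒↭ₛ′)
open import Data.List.Relation.Binary.Permutation.Propositional.Properties
  using (↭-length; ∈-resp-↭; ++⁺ˡ; ++⁺ʳ; ++-comm; shift; zoom; ++-commutativeMonoid)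
import Data.List.Relation.Binary.Permutation.Setoid.Properties as Permutationₛ
open import Data.List.Relation.Unary.All as All using (All; []; _∷_)
import Data.List.Relation.Unary.All.Properties as Allₚ
open import Data.List.Relation.Unary.AllPairs using ([]; _∷_)
open import Data.List.Relation.Unary.Any using (here; there)
open import Data.List.Relation.Unary.Unique.Propositional using (Unique)
import Data.List.Relation.Unary.Unique.Propositional.Properties as Unique
open import Data.Maybe using (just)
open import Data.Maybe.Properties using (just-injective)
open import Data.Nat using (ℕ; zero; suc; _+_; _*_; _≤_; _<_; _>_; z≤n; s≤s; _≟_; _≤?_; _<?_)
open import Data.Nat.Induction using (<-rec)
open import Data.Nat.ListAction using (sum)
open import Data.Nat.Properties
  using ( 1+n≢n; suc-injective; +-comm; +-assoc; +-suc; +-identityʳ; +-cancelˡ-≡; +-cancelʳ-≡; +-cancelˡ-≤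
        ; +-mono-≤; +-monoʳ-≤; *-monoʳ-≤; ≤-refl; ≤-reflexive; ≤-trans; ≤-pred; <-irrefl; <-trans; <-≤-trans; <-cmp
        ; ≮⇒≥; m≤n⇒m<n∨m≡n; m≤m+n; m≤n+m; m<m+n; n≤1+n; n<1+n; module ≤-Reasoning)
open import Data.Nat.Tactic.RingSolver using (solve-∀)
open import Data.Product using (Σ; _×_; _,_; proj₁; proj₂; ∃; ∃₂)
open import Data.Sum using (_⊎_; inj₁; inj₂; [_,_])
import Data.Sum
open import Data.Unit using (⊤; tt)
open import Data.Vec using (Vec; []; _∷_; toList)
open import Function using (_∘_)
open import Function.Bundles using (_⇔_; mk⇔)
open import Relation.Binary using (tri<; tri≈; tri>)
open import Relation.Binary.PropositionalEquality hiding ([_])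
open import Relation.Nullary using (¬_; ¬?; does; yes; no)
open import Relation.Unary using (Decidable; _⊆_; _≐_; _∪_; ∁)
open import Relation.Unary.Properties using (≐-refl; ≐-sym; ≐-trans)

module _ {A : Set} where

  lastOr : A → List A → A
  lastOr x []       = x
  lastOr x (y ∷ ys) = lastOr y ys

  last-∷ : ∀ x xs → last (x ∷ xs) ≡ just (lastOr x xs)
  last-∷ x []           = refl
  last-∷ x (y ∷ [])     = refl
  last-∷ x (y ∷ z ∷ ys) = last-∷ z ys

  lastOr-++ : ∀ x xs y ys → lastOr x (xs ++ y ∷ ys) ≡ lastOr y ys
  lastOr-++ x []       y ys = refl
  lastOr-++ x (z ∷ xs) y ys = lastOr-++ z xs y ys

lastOr-map : ∀ {A B : Set} (f : A → B) x xs → lastOr (f x) (map f xs) ≡ f (lastOr x xs)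
lastOr-map f x []       = refl
lastOr-map f x (y ∷ ys) = lastOr-map f y ys

module _ {A : Set} where

  Unique-resp-↭ : ∀ {xs ys : List A} → xs ↭ ys → Unique xs → Unique ys
  Unique-resp-↭ p = Permutationₛ.Unique-resp-↭ (setoid A) (↭⇒↭ₛ′ isEquivalence p)

  Unique-++⁻ˡ : ∀ (xs : List A) {ys} → Unique (xs ++ ys) → Unique xs
  Unique-++⁻ˡ []       _          = []
  Unique-++⁻ˡ (x ∷ xs) (x∉ ∷ uxs) = Allₚ.++⁻ˡ xs x∉ ∷ Unique-++⁻ˡ xs uxs

  Unique-++⁻ʳ : ∀ (xs : List A) {ys} → Unique (xs ++ ys) → Unique ys
  Unique-++⁻ʳ []       u         = u
  Unique-++⁻ʳ (x ∷ xs) (_ ∷ uxs) = Unique-++⁻ʳ xs uxs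

  Unique-concat⁻ : ∀ (xss : List (List A)) → Unique (concat xss) → All Unique xss
  Unique-concat⁻ []         _ = []
  Unique-concat⁻ (xs ∷ xss) u = Unique-++⁻ˡ xs u ∷ Unique-concat⁻ xss (Unique-++⁻ʳ xs u)

  Unique-++⇒disjoint : ∀ (xs : List A) {ys x} → Unique (xs ++ ys) → x ∈ xs → x ∉ ys
  Unique-++⇒disjoint (_ ∷ xs) (x∉ ∷ _)   (here refl)  x∈ys = All.lookup x∉ (∈-++⁺ʳ xs x∈ys) refl
  Unique-++⇒disjoint (_ ∷ xs) (_  ∷ uxs) (there x∈xs) x∈ys = Unique-++⇒disjoint xs uxs x∈xs x∈ys

  Enumeration : List A → Set
  Enumeration xs = Unique xs × (∀ x → x ∈ xs)

  Enumeration-resp-↭ : ∀ {xs ys : List A} → xs ↭ ys → Enumeration xs → Enumeration ys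
  Enumeration-resp-↭ p (uxs , cover) = Unique-resp-↭ p uxs , λ x → ∈-resp-↭ p (cover x)

  splitVec : ∀ d (xs : List A) → d ≤ length xs →
             Σ (Vec A d) λ pre → ∃ λ ys → xs ≡ toList pre ++ ys × length xs ≡ d + length ys
  splitVec zero    xs       _        = [] , xs , refl , refl
  splitVec (suc d) (x ∷ xs) (s≤s d≤) with splitVec d xs d≤
  ... | pre , ys , refl , len = x ∷ pre , ys , refl , cong suc len

module _ {A B : Set} {P : A → Set} (f : A → B) (inj : ∀ {x y} → P x → P y → f x ≡ f y → x ≡ y) where

  Unique-map⁺-on : ∀ {xs} → All P xs → Unique xs → Unique (map f xs)
  Unique-map⁺-on {[]}     []         []         = []
  Unique-map⁺-on {x ∷ xs} (px ∷ pxs) (x∉ ∷ uxs) = distinct pxs x∉ ∷ Unique-map⁺-on pxs uxs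
    where
    distinct : ∀ {ys} → All P ys → All (λ y → ¬ x ≡ y) ys → All (λ y → ¬ f x ≡ y) (map f ys)
    distinct []         []           = []
    distinct (py ∷ pys) (x≢y ∷ x≢ys) = (λ e → x≢y (inj px py e)) ∷ distinct pys x≢ys

Enumeration-length : ∀ {n} {xs : List (Fin n)} → Enumeration xs → length xs ≡ n
Enumeration-length {n} (uxs , cover) =
  trans (↭-length (∼bag⇒↭ (unique∧set⇒bag uxs (Unique.allFin⁺ n) (mk⇔ (λ _ → ∈-allFin _) (λ _ → cover _)))))
        (length-tabulate (λ h → h))

module _ {A : Set} {P P′ Q Q′ : A → Set} where

  ∪-cong : P ≐ P′ → Q ≐ Q′ → P ∪ Q ≐ P′ ∪ Q′
  ∪-cong (P⊆P′ , P′⊆P) (Q⊆Q′ , Q′⊆Q) = Data.Sum.map P⊆P′ Q⊆Q′ , Data.Sum.map P′⊆P Q′⊆Q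

module _ {A : Set} {P Q : A → Set} where

  ∪-emptyˡ : (∀ {x} → ¬ P x) → P ∪ Q ≐ Q
  ∪-emptyˡ empty = [ ⊥-elim ∘ empty , (λ q → q) ] , inj₂

  ∪-emptyʳ : (∀ {x} → ¬ Q x) → P ∪ Q ≐ P
  ∪-emptyʳ empty = [ (λ p → p) , ⊥-elim ∘ empty ] , inj₁

module _ {A : Set} {P Q R : A → Set} where

  ∪-middle : P ∪ (Q ∪ R) ≐ Q ∪ (P ∪ R)
  ∪-middle = [ inj₂ ∘ inj₁ , [ inj₁ , inj₂ ∘ inj₂ ] ] , [ inj₂ ∘ inj₁ , [ inj₁ , inj₂ ∘ inj₂ ] ]

module _ {A : Set} where

  sumPairs : (A → A → ℕ) → List A → ℕ
  sumPairs f []           = 0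
  sumPairs f (x ∷ [])     = 0
  sumPairs f (x ∷ y ∷ xs) = f x y + sumPairs f (y ∷ xs)

  sumPairs-telescope : ∀ (w : A → ℕ) x xs →
    2 * sum (map w (x ∷ xs)) ≡ sumPairs (λ a b → w a + w b) (x ∷ xs) + w x + w (lastOr x xs)
  sumPairs-telescope w x []       = double (w x)
    where
    double : ∀ a → 2 * (a + 0) ≡ 0 + a + a
    double = solve-∀
  sumPairs-telescope w x (y ∷ xs) =
    trans (regroup₁ (w x) (sum (map w (y ∷ xs))))
          (trans (cong (w x + w x +_) (sumPairs-telescope w y xs))
                 (regroup₂ (w x) (w y) (sumPairs _ (y ∷ xs)) (w (lastOr y xs))))
    where
    regroup₁ : ∀ a s → 2 * (a + s) ≡ a + a + 2 * s
    regroup₁ = solve-∀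
    regroup₂ : ∀ a b s l → a + a + (s + b + l) ≡ a + b + s + a + l
    regroup₂ = solve-∀

  length-filter-≡-sum : ∀ {P : A → Set} (P? : Decidable P) xs →
    length (filter P? xs) ≡ sum (map (λ x → if does (P? x) then 1 else 0) xs)
  length-filter-≡-sum P? []       = refl
  length-filter-≡-sum P? (x ∷ xs) with does (P? x)
  ... | true  = cong suc (length-filter-≡-sum P? xs)
  ... | false = length-filter-≡-sum P? xs

δ : ℕ → ℕ → ℕ
δ c i = if does (i ≟ c) then 1 else 0

LayerStep : ℕ → ℕ → Set
LayerStep i j = (suc i ≡ j ⊎ suc j ≡ i) ⊎ i ≡ j

layerWeight : ℕ → ℕ
layerWeight 0             = 0
layerWeight 1             = 2
layerWeight (suc (suc _)) = 1

bottomStep : ℕ → ℕ → ℕ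
bottomStep 0 0 = 1
bottomStep _ _ = 0

crossing₁₂ : ℕ → ℕ → ℕ
crossing₁₂ 1 2 = 1
crossing₁₂ 2 1 = 1
crossing₁₂ _ _ = 0

layerWeight-step : ∀ i j → LayerStep i j → 2 + crossing₁₂ i j ≤ layerWeight i + layerWeight j + 2 * bottomStep i j
layerWeight-step 0 0 _                                   = s≤s (s≤s z≤n)
layerWeight-step 0 1 _                                   = s≤s (s≤s z≤n)
layerWeight-step 0 (suc (suc j)) (inj₁ (inj₁ ()))
layerWeight-step 0 (suc (suc j)) (inj₁ (inj₂ ()))
layerWeight-step 0 (suc (suc j)) (inj₂ ())
layerWeight-step 1 0 _                                   = s≤s (s≤s z≤n)
layerWeight-step 1 1 _                                   = s≤s (s≤s z≤n)
layerWeight-step 1 2 _                                   = s≤s (s≤s (s≤s z≤n))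
layerWeight-step 1 (suc (suc (suc j))) _                 = s≤s (s≤s z≤n)
layerWeight-step (suc (suc i)) 0 (inj₁ (inj₁ ()))
layerWeight-step (suc (suc i)) 0 (inj₁ (inj₂ ()))
layerWeight-step (suc (suc i)) 0 (inj₂ ())
layerWeight-step 2 1 _                                   = s≤s (s≤s (s≤s z≤n))
layerWeight-step (suc (suc (suc i))) 1 _                 = s≤s (s≤s z≤n)
layerWeight-step 2 (suc (suc j)) _                       = s≤s (s≤s z≤n)
layerWeight-step (suc (suc (suc i))) (suc (suc j)) _     = s≤s (s≤s z≤n)

layerWeight-balance : ∀ i → layerWeight i + δ 0 i ≡ 1 + δ 1 i
layerWeight-balance 0             = refl
layerWeight-balance 1             = refl
layerWeight-balance (suc (suc i)) = refl

crossing₁₂-step : ∀ i j → LayerStep i j → i ≤ 1 → ¬ j ≤ 1 → 1 ≤ crossing₁₂ i j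
crossing₁₂-step 0 0 _ _ j≰1                         = ⊥-elim (j≰1 z≤n)
crossing₁₂-step 0 1 _ _ j≰1                         = ⊥-elim (j≰1 (s≤s z≤n))
crossing₁₂-step 0 (suc (suc j)) (inj₁ (inj₁ ())) _ _
crossing₁₂-step 0 (suc (suc j)) (inj₁ (inj₂ ())) _ _
crossing₁₂-step 0 (suc (suc j)) (inj₂ ()) _ _
crossing₁₂-step 1 0 _ _ j≰1                         = ⊥-elim (j≰1 z≤n)
crossing₁₂-step 1 1 _ _ j≰1                         = ⊥-elim (j≰1 (s≤s z≤n))
crossing₁₂-step 1 2 _ _ _                           = s≤s z≤n
crossing₁₂-step 1 (suc (suc (suc j))) (inj₁ (inj₁ ())) _ _
crossing₁₂-step 1 (suc (suc (suc j))) (inj₁ (inj₂ ())) _ _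
crossing₁₂-step 1 (suc (suc (suc j))) (inj₂ ()) _ _
crossing₁₂-step (suc (suc i)) j _ (s≤s ()) _

step-balance : ∀ l C S E → 2 * suc l ≡ S + 2 + 2 → 2 * l + C ≤ S + 2 * E → 2 + C ≤ 2 * E
step-balance l C S E total ineq = +-cancelˡ-≤ (2 * l + 2) _ _
  (subst₂ _≤_ (regroupˡ l C) (trans (regroupʳ S E) (trans (cong (_+ 2 * E) (sym total)) (regroupʳ′ l E)))
          (+-mono-≤ ineq (≤-refl {4})))
  where
  regroupˡ : ∀ l C → 2 * l + C + 4 ≡ 2 * l + 2 + (2 + C)
  regroupˡ = solve-∀
  regroupʳ : ∀ S E → S + 2 * E + 4 ≡ S + 2 + 2 + 2 * E
  regroupʳ = solve-∀
  regroupʳ′ : ∀ l E → 2 * suc l + 2 * E ≡ 2 * l + 2 + 2 * E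
  regroupʳ′ = solve-∀

module LayerWeights {m n : ℕ} (H : Graph (Fin n)) where

  V : Set
  V = Fin m × Fin n

  G : Graph V
  G = lex (pathGraph m) H

  layer : V → ℕ
  layer x = toℕ (proj₁ x)

  weight : V → ℕ
  weight x = layerWeight (layer x)

  bottomEdges crossings : List V → ℕ
  bottomEdges = sumPairs (λ x y → bottomStep (layer x) (layer y))
  crossings   = sumPairs (λ x y → crossing₁₂ (layer x) (layer y))

  adj⇒layerStep : ∀ {x y} → Adj G x y → LayerStep (layer x) (layer y)
  adj⇒layerStep (inj₁ e)       = inj₁ e
  adj⇒layerStep (inj₂ (e , _)) = inj₂ (cong toℕ e)

  walk-weight : ∀ x xs → Walk (Adj G) (x ∷ xs) →
    2 * length xs + crossings (x ∷ xs) ≤ sumPairs (λ a b → weight a + weight b) (x ∷ xs) + 2 * bottomEdges (x ∷ xs)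
  walk-weight x []       _       = z≤n
  walk-weight x (y ∷ xs) (a , w) =
    subst₂ _≤_ (regroupˡ (length xs) (crossing₁₂ (layer x) (layer y)) (crossings (y ∷ xs)))
               (regroupʳ (weight x + weight y) (bottomStep (layer x) (layer y))
                         (sumPairs (λ a b → weight a + weight b) (y ∷ xs)) (bottomEdges (y ∷ xs)))
      (+-mono-≤ (layerWeight-step (layer x) (layer y) (adj⇒layerStep a)) (walk-weight y xs w))
    where
    regroupˡ : ∀ l c C → 2 + c + (2 * l + C) ≡ 2 * suc l + (c + C)
    regroupˡ = solve-∀
    regroupʳ : ∀ s b S E → s + 2 * b + (S + 2 * E) ≡ s + S + 2 * (b + E)
    regroupʳ = solve-∀

  sameLayer : ∀ {c x y} → layer x ≡ c → layer y ≡ c → proj₂ x ≡ proj₂ y → x ≡ y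
  sameLayer {x = _ , _} {_ , _} ex ey refl = cong (_, _) (toℕ-injective (trans ex (sym ey)))

  Unique-layer : ∀ c {xs} → Unique xs → Unique (map proj₂ (filter (λ x → layer x ≟ c) xs))
  Unique-layer c {xs} uxs =
    Unique-map⁺-on proj₂ sameLayer (Allₚ.all-filter (λ x → layer x ≟ c) xs) (Unique.filter⁺ (λ x → layer x ≟ c) uxs)

  layer-count : ∀ c (z : Fin m) → toℕ z ≡ c → ∀ {xs} → Enumeration xs → length (filter (λ x → layer x ≟ c) xs) ≡ n
  layer-count c z z≡c {xs} (uxs , cover) =
    trans (sym (length-map proj₂ (filter P? xs))) (Enumeration-length (Unique-layer c uxs , inLayer))
    where
    P? = λ x → layer x ≟ c
    inLayer : ∀ h → h ∈ map proj₂ (filter P? xs)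
    inLayer h = ∈-map⁺ proj₂ (∈-filter⁺ P? (cover (z , h)) z≡c)

  weight-balance : ∀ xs → sum (map weight xs) + sum (map (δ 0 ∘ layer) xs) ≡ length xs + sum (map (δ 1 ∘ layer) xs)
  weight-balance []       = refl
  weight-balance (x ∷ xs) =
    trans (regroup (weight x) (sum (map weight xs)) (δ 0 (layer x)) (sum (map (δ 0 ∘ layer) xs)))
          (trans (cong₂ _+_ (layerWeight-balance (layer x)) (weight-balance xs))
                 (regroup′ (δ 1 (layer x)) (length xs) (sum (map (δ 1 ∘ layer) xs))))
    where
    regroup : ∀ a s b t → a + s + (b + t) ≡ (a + b) + (s + t)
    regroup = solve-∀
    regroup′ : ∀ a l t → 1 + a + (l + t) ≡ suc l + (a + t)
    regroup′ = solve-∀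

  weight-sum : (z o : Fin m) → toℕ z ≡ 0 → toℕ o ≡ 1 → ∀ {xs} → Enumeration xs → sum (map weight xs) ≡ length xs
  weight-sum z o z≡0 o≡1 {xs} enum = +-cancelʳ-≡ n _ _ (begin
    sum (map weight xs) + n                        ≡⟨ cong (sum (map weight xs) +_) (count 0 z z≡0) ⟩
    sum (map weight xs) + sum (map (δ 0 ∘ layer) xs) ≡⟨ weight-balance xs ⟩
    length xs + sum (map (δ 1 ∘ layer) xs)         ≡⟨ cong (length xs +_) (sym (count 1 o o≡1)) ⟩
    length xs + n                                  ∎)
    where
    open ≡-Reasoning
    count : ∀ c (t : Fin m) → toℕ t ≡ c → n ≡ sum (map (δ c ∘ layer) xs)
    count c t t≡c = trans (sym (layer-count c t t≡c enum)) (length-filter-≡-sum (λ x → layer x ≟ c) xs)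

  nextLayer : List V → ℕ
  nextLayer []      = 1
  nextLayer (y ∷ _) = layer y

  pushRun : ℕ → Fin n → ℕ → List (List (Fin n)) → List (List (Fin n))
  pushRun (suc _) h _       rs       = rs
  pushRun zero    h zero    (r ∷ rs) = (h ∷ r) ∷ rs
  pushRun zero    h zero    []       = (h ∷ []) ∷ []
  pushRun zero    h (suc _) rs       = (h ∷ []) ∷ rs

  -- The maximal runs of a walk inside layer 0, projected to H.
  bottomRuns : List V → List (List (Fin n))
  bottomRuns []       = []
  bottomRuns (x ∷ xs) = pushRun (layer x) (proj₂ x) (nextLayer xs) (bottomRuns xs)

  bottomRuns-∷ : ∀ y xs → layer y ≡ 0 → ∃₂ λ r rs → bottomRuns (y ∷ xs) ≡ (proj₂ y ∷ r) ∷ rs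
  bottomRuns-∷ y xs y∈0 rewrite y∈0 = pushed (nextLayer xs) (bottomRuns xs) (continues xs)
    where
    continues : ∀ xs → nextLayer xs ≡ 0 → ∃₂ λ r rs → bottomRuns xs ≡ r ∷ rs
    continues []       ()
    continues (z ∷ zs) z∈0 with bottomRuns-∷ z zs z∈0
    ... | r , rs , eq = proj₂ z ∷ r , rs , eq
    pushed : ∀ j rs → (j ≡ 0 → ∃₂ λ r rs′ → rs ≡ r ∷ rs′) → ∃₂ λ r rs′ → pushRun 0 (proj₂ y) j rs ≡ (proj₂ y ∷ r) ∷ rs′
    pushed (suc j) rs _ = [] , rs , refl
    pushed zero    rs nonEmpty with nonEmpty refl
    ... | r , rs′ , refl = r , rs′ , refl

  forestEdges-bottomRuns : ∀ xs → forestEdges (bottomRuns xs) ≡ bottomEdges xs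
  forestEdges-bottomRuns []           = refl
  forestEdges-bottomRuns (x ∷ [])     with layer x
  ... | zero  = refl
  ... | suc _ = refl
  forestEdges-bottomRuns (x ∷ y ∷ xs) =
    trans (pushed (layer x) (layer y) (λ _ y∈0 → bottomRuns-∷ y xs y∈0))
          (cong (bottomStep (layer x) (layer y) +_) (forestEdges-bottomRuns (y ∷ xs)))
    where
    pushed : ∀ i j → (i ≡ 0 → j ≡ 0 → ∃₂ λ r rs → bottomRuns (y ∷ xs) ≡ (proj₂ y ∷ r) ∷ rs) →
             forestEdges (pushRun i (proj₂ x) j (bottomRuns (y ∷ xs))) ≡ bottomStep i j + forestEdges (bottomRuns (y ∷ xs))
    pushed (suc i) j       _    = refl
    pushed zero    (suc j) _    = refl
    pushed zero    zero    cont with cont refl refl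
    ... | r , rs , eq rewrite eq = refl

  concat-bottomRuns : ∀ xs → concat (bottomRuns xs) ≡ map proj₂ (filter (λ x → layer x ≟ 0) xs)
  concat-bottomRuns []       = refl
  concat-bottomRuns (x ∷ xs) with layer x ≟ 0
  ... | yes x∈0 = trans (pushed (layer x) (nextLayer xs) (bottomRuns xs) x∈0)
                        (trans (cong (proj₂ x ∷_) (concat-bottomRuns xs))
                               (sym (cong (map proj₂) (filter-accept (λ x → layer x ≟ 0) {x} {xs} x∈0))))
    where
    pushed : ∀ i j rs → i ≡ 0 → concat (pushRun i (proj₂ x) j rs) ≡ proj₂ x ∷ concat rs
    pushed zero zero    (r ∷ rs) refl = refl
    pushed zero zero    []       refl = refl
    pushed zero (suc j) rs       refl = refl
  ... | no x∉0  = trans (skipped (layer x) x∉0)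
                        (trans (concat-bottomRuns xs)
                               (sym (cong (map proj₂) (filter-reject (λ x → layer x ≟ 0) {x} {xs} x∉0))))
    where
    skipped : ∀ i → ¬ i ≡ 0 → concat (pushRun i (proj₂ x) (nextLayer xs) (bottomRuns xs)) ≡ concat (bottomRuns xs)
    skipped zero    i≢0 = ⊥-elim (i≢0 refl)
    skipped (suc i) _   = refl

  bottomAdj : ∀ {x y} → Adj G x y → layer x ≡ 0 → layer y ≡ 0 → Adj H (proj₂ x) (proj₂ y)
  bottomAdj (inj₁ (inj₁ e)) x∈0 y∈0 with trans e y∈0
  ... | ()
  bottomAdj (inj₁ (inj₂ e)) x∈0 y∈0 with trans e x∈0
  ... | ()
  bottomAdj (inj₂ (_ , a))  _   _   = a

  NonEmptyWalk : List (Fin n) → Set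
  NonEmptyWalk r = (¬ r ≡ []) × Walk (Adj H) r

  bottomRuns-walks : ∀ xs → Walk (Adj G) xs → All NonEmptyWalk (bottomRuns xs)
  bottomRuns-walks []           _ = []
  bottomRuns-walks (x ∷ [])     _ with layer x
  ... | zero  = ((λ ()) , tt) ∷ []
  ... | suc _ = []
  bottomRuns-walks (x ∷ y ∷ xs) (a , w) =
    pushed (layer x) (layer y) (bottomRuns-walks (y ∷ xs) w)
      (λ x∈0 y∈0 → let r , rs , eq = bottomRuns-∷ y xs y∈0 in r , rs , eq , bottomAdj a x∈0 y∈0)
    where
    pushed : ∀ i j → All NonEmptyWalk (bottomRuns (y ∷ xs)) →
             (i ≡ 0 → j ≡ 0 → ∃₂ λ r rs → bottomRuns (y ∷ xs) ≡ (proj₂ y ∷ r) ∷ rs × Adj H (proj₂ x) (proj₂ y)) →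
             All NonEmptyWalk (pushRun i (proj₂ x) j (bottomRuns (y ∷ xs)))
    pushed (suc i) j       walks _    = walks
    pushed zero    (suc j) walks _    = ((λ ()) , tt) ∷ walks
    pushed zero    zero    walks cont with cont refl refl
    ... | r , rs , eq , xy rewrite eq with walks
    ...   | (_ , w′) ∷ walks′ = ((λ ()) , xy , w′) ∷ walks′

  bottomRuns-spanning : (z : Fin m) → toℕ z ≡ 0 → ∀ xs → Walk (Adj G) xs → Enumeration xs →
                        SpanningLinearForest H (bottomRuns xs)
  bottomRuns-spanning z z≡0 xs w (uxs , cover) = paths (bottomRuns-walks xs w) (Unique-concat⁻ (bottomRuns xs) unique) , unique , covers
    where
    P? = λ x → layer x ≟ 0
    unique : Unique (concat (bottomRuns xs))
    unique = subst Unique (sym (concat-bottomRuns xs)) (Unique-layer 0 uxs)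
    paths : ∀ {rs} → All NonEmptyWalk rs → All Unique rs → All (IsPath H) rs
    paths []               []         = []
    paths ((ne , w) ∷ ws) (u ∷ us) = (ne , w , u) ∷ paths ws us
    covers : ∀ h → h ∈ concat (bottomRuns xs)
    covers h = subst (h ∈_) (sym (concat-bottomRuns xs)) (∈-map⁺ proj₂ (∈-filter⁺ P? (cover (z , h)) z≡0))

  walk-crosses₁₂ : ∀ x xs → Walk (Adj G) (x ∷ xs) → layer x ≤ 1 → ∀ y → y ∈ x ∷ xs → ¬ layer y ≤ 1 →
                   1 ≤ crossings (x ∷ xs)
  walk-crosses₁₂ x []       _       x≤1 y (here refl) y≰1 = ⊥-elim (y≰1 x≤1)
  walk-crosses₁₂ x (z ∷ zs) (a , w) x≤1 y y∈ y≰1 with layer z ≤? 1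
  ... | no z≰1 = ≤-trans (crossing₁₂-step (layer x) (layer z) (adj⇒layerStep a) x≤1 z≰1) (m≤m+n _ _)
  ... | yes z≤1 with y∈
  ...   | here refl = ⊥-elim (y≰1 x≤1)
  ...   | there y∈′ = ≤-trans (walk-crosses₁₂ z zs w z≤1 y y∈′ y≰1) (m≤n+m _ _)

  hamiltonianConnected⇒bottomRuns : (z o : Fin m) → toℕ z ≡ 0 → toℕ o ≡ 1 → (h₀ h₁ : Fin n) → ¬ h₀ ≡ h₁ →
    HamiltonianConnected G →
    ∃ λ p → SpanningLinearForest H (bottomRuns p) × 2 + crossings p ≤ 2 * bottomEdges p ×
            (∀ (t : Fin m) → ¬ toℕ t ≤ 1 → 1 ≤ crossings p)
  hamiltonianConnected⇒bottomRuns z o z≡0 o≡1 h₀ h₁ h₀≢h₁ hc with hc (o , h₀) (o , h₁) (λ e → h₀≢h₁ (cong proj₂ e))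
  ... | [] , (nonEmpty , _ , _) , _ = ⊥-elim (nonEmpty refl)
  ... | x ∷ xs , (_ , w , uxs) , cover , head≡ , last≡ =
    x ∷ xs , bottomRuns-spanning z z≡0 (x ∷ xs) w (uxs , cover) , balance , crosses
    where
    x≡ : x ≡ (o , h₀)
    x≡ = just-injective head≡
    end≡ : lastOr x xs ≡ (o , h₁)
    end≡ = just-injective (trans (sym (last-∷ x xs)) last≡)
    S = sumPairs (λ a b → weight a + weight b) (x ∷ xs)
    -- both ends lie in layer 1, of weight 2
    total : 2 * suc (length xs) ≡ S + 2 + 2
    total = begin
      2 * suc (length xs)                       ≡⟨ cong (2 *_) (sym (weight-sum z o z≡0 o≡1 (uxs , cover))) ⟩
      2 * sum (map weight (x ∷ xs))             ≡⟨ sumPairs-telescope weight x xs ⟩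
      S + weight x + weight (lastOr x xs)       ≡⟨ cong₂ (λ a b → S + layerWeight a + layerWeight b)
                                                         (trans (cong layer x≡) o≡1) (trans (cong layer end≡) o≡1) ⟩
      S + 2 + 2                                 ∎
      where open ≡-Reasoning
    balance : 2 + crossings (x ∷ xs) ≤ 2 * bottomEdges (x ∷ xs)
    balance = step-balance (length xs) (crossings (x ∷ xs)) S (bottomEdges (x ∷ xs)) total (walk-weight x xs w)
    crosses : ∀ (t : Fin m) → ¬ toℕ t ≤ 1 → 1 ≤ crossings (x ∷ xs)
    crosses t t≰1 = walk-crosses₁₂ x xs w (subst (_≤ 1) (sym (trans (cong layer x≡) o≡1)) ≤-refl) (t , h₀) (cover (t , h₀)) t≰1

private
  half≥1 : ∀ c e → 2 + c ≤ 2 * e → 1 ≤ e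
  half≥1 c zero    ()
  half≥1 c (suc e) _ = s≤s z≤n

  half≥2 : ∀ c e → 1 ≤ c → 2 + c ≤ 2 * e → 2 ≤ e
  half≥2 c       zero          _ ()
  half≥2 (suc c) (suc zero)    _ (s≤s (s≤s ()))
  half≥2 c       (suc (suc e)) _ _ = s≤s (s≤s z≤n)

  fin : ∀ {m} i → i < m → Σ (Fin m) λ z → toℕ z ≡ i
  fin i i<m = fromℕ< i<m , toℕ-fromℕ< i<m

  two-distinct : ∀ {n} → 2 ≤ n → ∃₂ λ (a b : Fin n) → ¬ a ≡ b
  two-distinct (s≤s (s≤s _)) = Fin.zero , Fin.suc Fin.zero , λ ()

module _ {m n : ℕ} (H : Graph (Fin n)) where
  open LayerWeights {m} H

  hamiltonianConnected⇒π≥1 : 2 ≤ m → 2 ≤ n → HamiltonianConnected (lex (pathGraph m) H) → πAtLeast H 1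
  hamiltonianConnected⇒π≥1 m≥2 n≥2 hc with fin 0 (≤-trans (s≤s z≤n) m≥2) | fin 1 m≥2 | two-distinct n≥2
  ... | z , z≡0 | o , o≡1 | h₀ , h₁ , h₀≢h₁ with hamiltonianConnected⇒bottomRuns z o z≡0 o≡1 h₀ h₁ h₀≢h₁ hc
  ... | p , forest , balance , _ = bottomRuns p , forest , subst (1 ≤_) (sym (forestEdges-bottomRuns p)) (half≥1 _ _ balance)

  hamiltonianConnected⇒π≥2 : 3 ≤ m → 2 ≤ n → HamiltonianConnected (lex (pathGraph m) H) → πAtLeast H 2
  hamiltonianConnected⇒π≥2 m≥3 n≥2 hc with fin 0 (≤-trans (s≤s z≤n) m≥3) | fin 1 (≤-trans (s≤s (s≤s z≤n)) m≥3) | fin 2 m≥3 | two-distinct n≥2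
  ... | z , z≡0 | o , o≡1 | t , t≡2 | h₀ , h₁ , h₀≢h₁ with hamiltonianConnected⇒bottomRuns z o z≡0 o≡1 h₀ h₁ h₀≢h₁ hc
  ... | p , forest , balance , crosses =
    bottomRuns p , forest ,
    subst (2 ≤_) (sym (forestEdges-bottomRuns p)) (half≥2 _ _ (crosses t (λ t≤1 → 2≰1 (subst (_≤ 1) t≡2 t≤1))) balance)
    where
    2≰1 : ¬ 2 ≤ 1
    2≰1 (s≤s ())

record Segment {A : Set} (R : A → A → Set) (u v : A) : Set where
  constructor segment
  field
    rest : List A
    walk : Walk R (u ∷ rest)
    ends : lastOr u rest ≡ v

  vertices : List A
  vertices = u ∷ rest

open Segment public using (vertices)

module _ {A : Set} {R : A → A → Set} where

  walk-++ : ∀ u xs w ys → Walk R (u ∷ xs) → R (lastOr u xs) w → Walk R (w ∷ ys) → Walk R (u ∷ xs ++ w ∷ ys)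
  walk-++ u []       w ys _          e walk′ = e , walk′
  walk-++ u (x ∷ xs) w ys (e′ , walk) e walk′ = e′ , walk-++ x xs w ys walk e walk′

  trivial : ∀ {u} → Segment R u u
  trivial = segment [] tt refl

  infixr 5 _++⟨_⟩_ _∷⟨_⟩_

  _++⟨_⟩_ : ∀ {u v w z} → Segment R u v → R v w → Segment R w z → Segment R u z
  _++⟨_⟩_ {u} {w = w} (segment xs walk ends) e (segment ys walk′ ends′) =
    segment (xs ++ w ∷ ys) (walk-++ u xs w ys walk (subst (λ t → R t w) (sym ends) e) walk′)
            (trans (lastOr-++ u xs w ys) ends′)

  _∷⟨_⟩_ : ∀ u {w z} → R u w → Segment R w z → Segment R u z
  u ∷⟨ e ⟩ s = trivial {u} ++⟨ e ⟩ s

  reverse : (∀ {x y} → R x y → R y x) → ∀ {u v} (s : Segment R u v) →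
            Σ (Segment R v u) λ s′ → vertices s′ ↭ vertices s
  reverse sym (segment [] tt refl) = trivial , ↭-refl
  reverse sym {u} (segment (x ∷ xs) (e , walk) ends) with reverse sym (segment xs walk ends)
  ... | s′ , s′↭ = s′ ++⟨ sym e ⟩ trivial , ↭-trans (++⁺ʳ (u ∷ []) s′↭) (++-comm (x ∷ xs) (u ∷ []))

module _ {A B : Set} {R : A → A → Set} {R′ : B → B → Set} (f : A → B) (f-hom : ∀ {x y} → R x y → R′ (f x) (f y)) where

  Segment-map : ∀ {u v} → Segment R u v → Segment R′ (f u) (f v)
  Segment-map {u} (segment xs walk ends) = segment (map f xs) (walk-map u xs walk) (trans (lastOr-map f u xs) (cong f ends))
    where
    walk-map : ∀ x xs → Walk R (x ∷ xs) → Walk R′ (f x ∷ map f xs)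
    walk-map x []       _          = tt
    walk-map x (y ∷ ys) (e , walk) = f-hom e , walk-map y ys walk

LayerAdj : ℕ → ℕ → Set
LayerAdj i j = suc i ≡ j ⊎ suc j ≡ i

LayerAdj-sym : ∀ {i j} → LayerAdj i j → LayerAdj j i
LayerAdj-sym (inj₁ e) = inj₂ e
LayerAdj-sym (inj₂ e) = inj₁ e

-- The lexicographic product P_ℕ[H] of the one-way infinite path with H.
module Layered {n : ℕ} (H : Graph (Fin n)) where

  W : Set
  W = ℕ × Fin n

  _~_ : W → W → Set
  (i , h) ~ (j , h′) = LayerAdj i j ⊎ (i ≡ j × Adj H h h′)

  ~-sym : ∀ {x y} → x ~ y → y ~ x
  ~-sym (inj₁ a)          = inj₁ (LayerAdj-sym a)
  ~-sym (inj₂ (refl , a)) = inj₂ (refl , Graph.sym H a)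

  InLayers : ℕ → ℕ → W → Set
  InLayers L₁ L₂ x = proj₁ x ≡ L₁ ⊎ proj₁ x ≡ L₂

  record HamiltonianPath (S : W → Set) (u v : W) : Set where
    constructor hamiltonianPath
    field
      path     : Segment _~_ u v
      unique   : Unique (vertices path)
      sound    : ∀ {x} → x ∈ vertices path → S x
      complete : ∀ {x} → S x → x ∈ vertices path

  open HamiltonianPath

  module _ {S : W → Set} where

    HamiltonianPath-resp : ∀ {S′ u v} → S ≐ S′ → HamiltonianPath S u v → HamiltonianPath S′ u v
    HamiltonianPath-resp (S⊆S′ , S′⊆S) p = hamiltonianPath (path p) (unique p) (S⊆S′ ∘ sound p) (complete p ∘ S′⊆S)

    HamiltonianPath-reverse : ∀ {u v} → HamiltonianPath S u v → HamiltonianPath S v u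
    HamiltonianPath-reverse p with reverse ~-sym (path p)
    ... | p′ , p′↭p = record
      { path     = p′
      ; unique   = Unique-resp-↭ (↭-sym p′↭p) (unique p)
      ; sound    = sound p ∘ ∈-resp-↭ p′↭p
      ; complete = ∈-resp-↭ (↭-sym p′↭p) ∘ complete p
      }

    join : ∀ {S′ u x y v} → S ⊆ ∁ S′ → HamiltonianPath S u x → x ~ y → HamiltonianPath S′ y v →
           HamiltonianPath (S ∪ S′) u v
    join S⊥S′ p e q = record
      { path     = path p ++⟨ e ⟩ path q
      ; unique   = Unique.++⁺ (unique p) (unique q) (λ (x∈p , x∈q) → S⊥S′ (sound p x∈p) (sound q x∈q))
      ; sound    = Data.Sum.map (sound p) (sound q) ∘ ∈-++⁻ (vertices (path p))
      ; complete = [ ∈-++⁺ˡ ∘ complete p , ∈-++⁺ʳ (vertices (path p)) ∘ complete q ]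
      }

  segment⇒hamiltonianPath : ∀ {u v} (s : Segment _~_ u v) → Unique (vertices s) → HamiltonianPath (_∈ vertices s) u v
  segment⇒hamiltonianPath s us = hamiltonianPath s us (λ x∈ → x∈) (λ x∈ → x∈)

module Complement (n : ℕ) where

  open import Data.List.Membership.DecPropositional (Fin._≟_ {n}) using (_∈?_)

  others : List (Fin n) → List (Fin n)
  others S = filter (λ h → ¬? (h ∈? S)) (allFin n)

  others-enumeration : ∀ S → Unique S → Enumeration (S ++ others S)
  others-enumeration S uS = Unique.++⁺ uS (Unique.filter⁺ _ (Unique.allFin⁺ n)) disjoint , cover
    where
    disjoint : ∀ {h} → ¬ (h ∈ S × h ∈ others S)
    disjoint (h∈S , h∈others) = proj₂ (∈-filter⁻ (λ h → ¬? (h ∈? S)) {xs = allFin n} h∈others) h∈S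
    cover : ∀ h → h ∈ S ++ others S
    cover h with h ∈? S
    ... | yes h∈S = ∈-++⁺ˡ h∈S
    ... | no  h∉S = ∈-++⁺ʳ S (∈-filter⁺ (λ h → ¬? (h ∈? S)) (∈-allFin h) h∉S)

  length-others : ∀ S → Unique S → length S + length (others S) ≡ n
  length-others S uS = trans (sym (length-++ S)) (Enumeration-length (others-enumeration S uS))

  -- A zigzag through a block pairs off the vertices left over in its two layers, so these must be equally many.
  others-align : ∀ {S S′} d d′ → Unique S → Unique S′ → length S + d ≡ length S′ + d′ → length S + d ≤ n →
    Σ (Vec (Fin n) d) λ pre → Σ (Vec (Fin n) d′) λ pre′ → ∃₂ λ xs xs′ →
      others S ≡ toList pre ++ xs × others S′ ≡ toList pre′ ++ xs′ × length xs ≡ length xs′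
  others-align {S} {S′} d d′ uS uS′ balanced fits
    with splitVec d (others S) (+-cancelˡ-≤ (length S) _ _ (≤-trans fits (≤-reflexive (sym (length-others S uS)))))
       | splitVec d′ (others S′) (+-cancelˡ-≤ (length S′) _ _
                                   (≤-trans (≤-reflexive (sym balanced)) (≤-trans fits (≤-reflexive (sym (length-others S′ uS′))))))
  ... | pre , xs , split , len | pre′ , xs′ , split′ , len′ =
    pre , pre′ , xs , xs′ , split , split′ , +-cancelˡ-≡ (length S + d) _ _ (begin
      length S + d + length xs       ≡⟨ +-assoc (length S) d _ ⟩
      length S + (d + length xs)     ≡⟨ cong (length S +_) (sym len) ⟩
      length S + length (others S)   ≡⟨ trans (length-others S uS) (sym (length-others S′ uS′)) ⟩
      length S′ + length (others S′) ≡⟨ cong (length S′ +_) len′ ⟩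
      length S′ + (d′ + length xs′)  ≡⟨ sym (+-assoc (length S′) d′ _) ⟩
      length S′ + d′ + length xs′    ≡⟨ cong (_+ length xs′) (sym balanced) ⟩
      length S + d + length xs′      ∎)
    where open ≡-Reasoning

module TwoLayers {n : ℕ} (H : Graph (Fin n)) where

  open Layered H

  T : Set
  T = Bool × Fin n

  -- K₂[H]; the layer tagged true is the one through which detours leave the block.
  _⌢_ : T → T → Set
  (true  , h) ⌢ (true  , h′) = Adj H h h′
  (true  , _) ⌢ (false , _)  = ⊤
  (false , _) ⌢ (true  , _)  = ⊤
  (false , h) ⌢ (false , h′) = Adj H h h′

  zig : Bool → List (Fin n) → List (Fin n) → List T
  zig b (x ∷ xs) (y ∷ ys) = (not b , x) ∷ (b , y) ∷ zig b xs ys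
  zig b _        _        = []

  zigEnd : Fin n → List (Fin n) → List (Fin n) → Fin n
  zigEnd h (x ∷ xs) (y ∷ ys) = zigEnd y xs ys
  zigEnd h _        _        = h

  zigzag : ∀ b h xs ys → Segment _⌢_ (b , h) (b , zigEnd h xs ys)
  zigzag b h xs ys = segment (zig b xs ys) (walk b h xs ys) (ends h xs ys)
    where
    walk : ∀ b h xs ys → Walk _⌢_ ((b , h) ∷ zig b xs ys)
    walk b     h []       _        = tt
    walk b     h (x ∷ xs) []       = tt
    walk true  h (x ∷ xs) (y ∷ ys) = tt , tt , walk true y xs ys
    walk false h (x ∷ xs) (y ∷ ys) = tt , tt , walk false y xs ys
    ends : ∀ h xs ys → lastOr (b , h) (zig b xs ys) ≡ (b , zigEnd h xs ys)
    ends h []       _        = refl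
    ends h (x ∷ xs) []       = refl
    ends h (x ∷ xs) (y ∷ ys) = ends y xs ys

  ⊤[_] ⊥[_] : Fin n → List T
  ⊤[ h ] = (true , h) ∷ []
  ⊥[ h ] = (false , h) ∷ []

  ⊤* ⊥* : List (Fin n) → List T
  ⊤* = map (true ,_)
  ⊥* = map (false ,_)

  tagged : List (Fin n) → List (Fin n) → List T
  tagged xs ys = ⊤* xs ++ ⊥* ys

  zig-↭ : ∀ b xs ys → length xs ≡ length ys → zig b xs ys ↭ map (not b ,_) xs ++ map (b ,_) ys
  zig-↭ b []       []       _   = ↭-refl
  zig-↭ b (x ∷ xs) (y ∷ ys) len =
    prep (not b , x) (↭-trans (prep (b , y) (zig-↭ b xs ys (suc-injective len)))
                              (↭-sym (shift (b , y) (map (not b ,_) xs) (map (b ,_) ys))))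

  tagged-enumeration : ∀ {xs ys} → Enumeration xs → Enumeration ys → Enumeration (tagged xs ys)
  tagged-enumeration {xs} {ys} (uxs , xs-cover) (uys , ys-cover) =
    Unique.++⁺ (Unique.map⁺ (λ { refl → refl }) uxs) (Unique.map⁺ (λ { refl → refl }) uys) disjoint , cover
    where
    disjoint : ∀ {t} → ¬ (t ∈ ⊤* xs × t ∈ ⊥* ys)
    disjoint (t∈xs , t∈ys) with ∈-map⁻ (true ,_) t∈xs | ∈-map⁻ (false ,_) t∈ys
    ... | _ , _ , refl | _ , _ , ()
    cover : ∀ t → t ∈ tagged xs ys
    cover (true  , h) = ∈-++⁺ˡ (∈-map⁺ (true ,_) (xs-cover h))
    cover (false , h) = ∈-++⁺ʳ (⊤* xs) (∈-map⁺ (false ,_) (ys-cover h))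

  record BlockPath (s t : T) : Set where
    constructor blockPath
    field
      path        : Segment _⌢_ s t
      enumeration : Enumeration (vertices path)

  -- Spans K₂[H] except for a detour that leaves and re-enters through the layer true.
  record BlockPath₁ (s t : T) : Set where
    constructor blockPath₁
    field
      {exit entry} : Fin n
      first        : Segment _⌢_ s (true , exit)
      second       : Segment _⌢_ (true , entry) t
      enumeration  : Enumeration (vertices first ++ vertices second)

  -- Spans K₂[H] except for a detour through the layer true and then one through the layer false.
  record BlockPath₂ (s t : T) : Set where
    constructor blockPath₂
    field
      {exit₁ entry₁ exit₂ entry₂} : Fin n
      first       : Segment _⌢_ s (true , exit₁)
      second      : Segment _⌢_ (true , entry₁) (false , exit₂)
      third       : Segment _⌢_ (false , entry₂) t
      enumeration : Enumeration (vertices first ++ vertices second ++ vertices third)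

  module Block (L₁ L₂ : ℕ) (L₁L₂ : LayerAdj L₁ L₂) where

    embed : T → W
    embed (true  , h) = L₁ , h
    embed (false , h) = L₂ , h

    InBlock : W → Set
    InBlock = InLayers L₁ L₂

    embed-adj : ∀ {s t} → s ⌢ t → embed s ~ embed t
    embed-adj {true  , _} {true  , _} a = inj₂ (refl , a)
    embed-adj {true  , _} {false , _} _ = inj₁ L₁L₂
    embed-adj {false , _} {true  , _} _ = inj₁ (LayerAdj-sym L₁L₂)
    embed-adj {false , _} {false , _} a = inj₂ (refl , a)

    L₁≢L₂ : ¬ L₁ ≡ L₂
    L₁≢L₂ refl = [ 1+n≢n , 1+n≢n ] L₁L₂

    embed-injective : ∀ {s t} → embed s ≡ embed t → s ≡ t
    embed-injective {true  , _} {true  , _} refl = refl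
    embed-injective {true  , _} {false , _} e    = ⊥-elim (L₁≢L₂ (cong proj₁ e))
    embed-injective {false , _} {true  , _} e    = ⊥-elim (L₁≢L₂ (sym (cong proj₁ e)))
    embed-injective {false , _} {false , _} refl = refl

    ∈-embed⇒InBlock : ∀ ts {x} → x ∈ map embed ts → InBlock x
    ∈-embed⇒InBlock _ x∈ with ∈-map⁻ embed x∈
    ... | (true  , _) , _ , refl = inj₁ refl
    ... | (false , _) , _ , refl = inj₂ refl

    InBlock⇒∈-embed : ∀ {x ts} → Enumeration ts → InBlock x → x ∈ map embed ts
    InBlock⇒∈-embed {_ , h} (_ , cover) (inj₁ refl) = ∈-map⁺ embed (cover (true , h))
    InBlock⇒∈-embed {_ , h} (_ , cover) (inj₂ refl) = ∈-map⁺ embed (cover (false , h))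

    piece : ∀ {s t} (σ : Segment _⌢_ s t) → Unique (map embed (vertices σ)) →
            HamiltonianPath (_∈ map embed (vertices σ)) (embed s) (embed t)
    piece σ = segment⇒hamiltonianPath (Segment-map embed (λ {s t} → embed-adj {s} {t}) σ)

    Unique-embed : ∀ {ts} → Unique ts → Unique (map embed ts)
    Unique-embed = Unique.map⁺ embed-injective

    blockPath⇒hamiltonianPath : ∀ {s t} → BlockPath s t → HamiltonianPath InBlock (embed s) (embed t)
    blockPath⇒hamiltonianPath (blockPath σ enum) =
      HamiltonianPath-resp (∈-embed⇒InBlock (vertices σ) , InBlock⇒∈-embed enum) (piece σ (Unique-embed (proj₁ enum)))

    module _ {s t : T} {P : ℕ} {O : W → Set} {a b : Fin n}
             (L₁P : LayerAdj L₁ P) (O⊥block : O ⊆ ∁ InBlock) (detour : HamiltonianPath O (P , a) (P , b)) where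

      blockPath₁⇒hamiltonianPath : BlockPath₁ s t → HamiltonianPath (InBlock ∪ O) (embed s) (embed t)
      blockPath₁⇒hamiltonianPath (blockPath₁ σ τ enum) =
        HamiltonianPath-resp (sound , complete)
          (join σO⊥τ (join σ⊥O (piece σ (Unique-++⁻ˡ Vσ unique)) (inj₁ L₁P) detour)
                (inj₁ (LayerAdj-sym L₁P)) (piece τ (Unique-++⁻ʳ Vσ unique)))
        where
        Vσ = map embed (vertices σ)
        Vτ = map embed (vertices τ)
        unique : Unique (Vσ ++ Vτ)
        unique = subst Unique (map-++ embed (vertices σ) (vertices τ)) (Unique-embed (proj₁ enum))
        σ⊥O : (_∈ Vσ) ⊆ ∁ O
        σ⊥O x∈σ x∈O = O⊥block x∈O (∈-embed⇒InBlock (vertices σ) x∈σ)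
        σO⊥τ : ((_∈ Vσ) ∪ O) ⊆ ∁ (_∈ Vτ)
        σO⊥τ = [ Unique-++⇒disjoint Vσ unique , (λ x∈O x∈τ → O⊥block x∈O (∈-embed⇒InBlock (vertices τ) x∈τ)) ]
        sound : ((_∈ Vσ) ∪ O) ∪ (_∈ Vτ) ⊆ InBlock ∪ O
        sound = [ [ inj₁ ∘ ∈-embed⇒InBlock (vertices σ) , inj₂ ] , inj₁ ∘ ∈-embed⇒InBlock (vertices τ) ]
        complete : InBlock ∪ O ⊆ ((_∈ Vσ) ∪ O) ∪ (_∈ Vτ)
        complete {x} (inj₁ x∈block) with ∈-++⁻ Vσ (subst (x ∈_) (map-++ embed (vertices σ) (vertices τ)) (InBlock⇒∈-embed enum x∈block))
        ... | inj₁ x∈σ = inj₁ (inj₁ x∈σ)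
        ... | inj₂ x∈τ = inj₂ x∈τ
        complete (inj₂ x∈O) = inj₁ (inj₂ x∈O)

    module _ {s t : T} {P Q : ℕ} {OL OR : W → Set} {a b c d : Fin n}
             (L₁P : LayerAdj L₁ P) (L₂Q : LayerAdj L₂ Q)
             (OL⊥block : OL ⊆ ∁ InBlock) (OR⊥block : OR ⊆ ∁ InBlock) (OL⊥OR : OL ⊆ ∁ OR)
             (detourL : HamiltonianPath OL (P , a) (P , b)) (detourR : HamiltonianPath OR (Q , c) (Q , d)) where

      blockPath₂⇒hamiltonianPath : BlockPath₂ s t → HamiltonianPath (InBlock ∪ (OL ∪ OR)) (embed s) (embed t)
      blockPath₂⇒hamiltonianPath (blockPath₂ σ τ ρ enum) =
        HamiltonianPath-resp (sound , complete)
          (join σLτR⊥ρ (join σLτ⊥R (join σL⊥τ (join σ⊥L (piece σ uσ) (inj₁ L₁P) detourL)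
                                               (inj₁ (LayerAdj-sym L₁P)) (piece τ uτ))
                                   (inj₁ L₂Q) detourR)
                       (inj₁ (LayerAdj-sym L₂Q)) (piece ρ uρ))
        where
        Vσ = map embed (vertices σ)
        Vτ = map embed (vertices τ)
        Vρ = map embed (vertices ρ)
        all≡ : map embed (vertices σ ++ vertices τ ++ vertices ρ) ≡ Vσ ++ Vτ ++ Vρ
        all≡ = trans (map-++ embed (vertices σ) _) (cong (Vσ ++_) (map-++ embed (vertices τ) (vertices ρ)))
        unique : Unique (Vσ ++ Vτ ++ Vρ)
        unique = subst Unique all≡ (Unique-embed (proj₁ enum))
        uσ  = Unique-++⁻ˡ Vσ unique
        uτρ = Unique-++⁻ʳ Vσ unique
        uτ  = Unique-++⁻ˡ Vτ uτρ
        uρ  = Unique-++⁻ʳ Vτ uτρ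
        inBlock : ∀ {x} → (x ∈ Vσ ⊎ x ∈ Vτ) ⊎ x ∈ Vρ → InBlock x
        inBlock = [ [ ∈-embed⇒InBlock (vertices σ) , ∈-embed⇒InBlock (vertices τ) ] , ∈-embed⇒InBlock (vertices ρ) ]
        σ⊥L : (_∈ Vσ) ⊆ ∁ OL
        σ⊥L x∈σ x∈L = OL⊥block x∈L (inBlock (inj₁ (inj₁ x∈σ)))
        σL⊥τ : (_∈ Vσ) ∪ OL ⊆ ∁ (_∈ Vτ)
        σL⊥τ = [ (λ x∈σ x∈τ → Unique-++⇒disjoint Vσ unique x∈σ (∈-++⁺ˡ x∈τ))
               , (λ x∈L x∈τ → OL⊥block x∈L (inBlock (inj₁ (inj₂ x∈τ)))) ]
        σLτ⊥R : ((_∈ Vσ) ∪ OL) ∪ (_∈ Vτ) ⊆ ∁ OR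
        σLτ⊥R = [ [ (λ x∈σ x∈R → OR⊥block x∈R (inBlock (inj₁ (inj₁ x∈σ)))) , OL⊥OR ]
                , (λ x∈τ x∈R → OR⊥block x∈R (inBlock (inj₁ (inj₂ x∈τ)))) ]
        σLτR⊥ρ : (((_∈ Vσ) ∪ OL) ∪ (_∈ Vτ)) ∪ OR ⊆ ∁ (_∈ Vρ)
        σLτR⊥ρ = [ [ [ (λ x∈σ x∈ρ → Unique-++⇒disjoint Vσ unique x∈σ (∈-++⁺ʳ Vτ x∈ρ))
                     , (λ x∈L x∈ρ → OL⊥block x∈L (inBlock (inj₂ x∈ρ))) ]
                   , Unique-++⇒disjoint Vτ uτρ ]
                 , (λ x∈R x∈ρ → OR⊥block x∈R (inBlock (inj₂ x∈ρ))) ]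
        sound : ((((_∈ Vσ) ∪ OL) ∪ (_∈ Vτ)) ∪ OR) ∪ (_∈ Vρ) ⊆ InBlock ∪ (OL ∪ OR)
        sound = [ [ [ [ inj₁ ∘ inBlock ∘ inj₁ ∘ inj₁ , inj₂ ∘ inj₁ ] , inj₁ ∘ inBlock ∘ inj₁ ∘ inj₂ ] , inj₂ ∘ inj₂ ]
                , inj₁ ∘ inBlock ∘ inj₂ ]
        complete : InBlock ∪ (OL ∪ OR) ⊆ ((((_∈ Vσ) ∪ OL) ∪ (_∈ Vτ)) ∪ OR) ∪ (_∈ Vρ)
        complete {x} (inj₁ x∈block) with ∈-++⁻ Vσ (subst (x ∈_) all≡ (InBlock⇒∈-embed enum x∈block))
        ... | inj₁ x∈σ = inj₁ (inj₁ (inj₁ (inj₁ x∈σ)))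
        ... | inj₂ x∈τρ with ∈-++⁻ Vτ x∈τρ
        ...   | inj₁ x∈τ = inj₁ (inj₁ (inj₂ x∈τ))
        ...   | inj₂ x∈ρ = inj₂ x∈ρ
        complete (inj₂ (inj₁ x∈L)) = inj₁ (inj₁ (inj₁ (inj₂ x∈L)))
        complete (inj₂ (inj₂ x∈R)) = inj₁ (inj₂ x∈R)

  open Complement n

  Unique-length≤ : ∀ {S} → Unique S → length S ≤ n
  Unique-length≤ {S} uS = ≤-trans (m≤m+n (length S) _) (≤-reflexive (length-others S uS))

  tagged-others : ∀ {S S′ : List (Fin n)} {ts} pre xs pre′ xs′ → Unique S → Unique S′ →
                  others S ≡ pre ++ xs → others S′ ≡ pre′ ++ xs′ →
                  ts ↭ tagged (S ++ pre ++ xs) (S′ ++ pre′ ++ xs′) → Enumeration ts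
  tagged-others {S} {S′} pre xs pre′ xs′ uS uS′ split split′ ts↭ =
    Enumeration-resp-↭ (↭-sym ts↭)
      (tagged-enumeration (subst (λ l → Enumeration (S ++ l)) split (others-enumeration S uS))
                          (subst (λ l → Enumeration (S′ ++ l)) split′ (others-enumeration S′ uS′)))

module Constructions {n : ℕ} (H : Graph (Fin n)) where

  open TwoLayers H
  open Complement n
  open import Algebra.Solver.CommutativeMonoid (++-commutativeMonoid {A = T}) using (solve; _⊕_; _⊜_)

  unique₁ : ∀ (a : Fin n) → Unique (a ∷ [])
  unique₁ a = [] ∷ []

  unique₂ : ∀ {a b : Fin n} → ¬ a ≡ b → Unique (a ∷ b ∷ [])
  unique₂ a≢b = (a≢b ∷ []) ∷ [] ∷ []

  blockPath-TF : ∀ u₀ v₀ → BlockPath (true , u₀) (false , v₀)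
  blockPath-TF u₀ v₀
    with others-align 0 0 (unique₁ u₀) (unique₁ v₀) refl (≤-trans (s≤s z≤n) (toℕ<n u₀))
  ... | [] , [] , ys , xs , split , split′ , len = blockPath σ enumeration
    where
    σ = zigzag true u₀ xs ys ++⟨ tt ⟩ trivial
    enumeration = tagged-others [] ys [] xs (unique₁ u₀) (unique₁ v₀) split split′
      (↭-trans (zoom ⊤[ u₀ ] (zig-↭ true xs ys (sym len)))
               (solve 4 (λ u v X Y → u ⊕ ((X ⊕ Y) ⊕ v) ⊜ (u ⊕ Y) ⊕ (v ⊕ X)) ↭-refl ⊤[ u₀ ] ⊥[ v₀ ] (⊥* xs) (⊤* ys)))

  unique₃ : ∀ {a b c : Fin n} → ¬ a ≡ b → ¬ a ≡ c → ¬ b ≡ c → Unique (a ∷ b ∷ c ∷ [])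
  unique₃ a≢b a≢c b≢c = (a≢b ∷ a≢c ∷ []) ∷ (b≢c ∷ []) ∷ [] ∷ []

  adj⇒≢ : ∀ {a b} → Adj H a b → ¬ a ≡ b
  adj⇒≢ ab refl = Graph.irrefl H ab

  blockPath₁-TF-edge : ∀ u₀ {a b} → Adj H a b → BlockPath₁ (true , u₀) (false , b)
  blockPath₁-TF-edge u₀ {a} {b} ab
    with others-align 1 0 (unique₁ u₀) (unique₂ (adj⇒≢ ab)) refl (Unique-length≤ (unique₂ (adj⇒≢ ab)))
  ... | p₁ ∷ [] , [] , ps , xs , split , split′ , len = blockPath₁ trivial second enumeration
    where
    second = zigzag true p₁ xs ps ++⟨ tt ⟩ (false , a) ∷⟨ ab ⟩ trivial
    enumeration = tagged-others (p₁ ∷ []) ps [] xs (unique₁ u₀) (unique₂ (adj⇒≢ ab)) split split′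
      (↭-trans (zoom (⊤[ u₀ ] ++ ⊤[ p₁ ]) (zig-↭ true xs ps (sym len)))
               (solve 6 (λ u p a b X P → (u ⊕ p) ⊕ ((X ⊕ P) ⊕ (a ⊕ b)) ⊜ (u ⊕ (p ⊕ P)) ⊕ (a ⊕ (b ⊕ X)))
                      ↭-refl ⊤[ u₀ ] ⊤[ p₁ ] ⊥[ a ] ⊥[ b ] (⊥* xs) (⊤* ps)))

  module _ {a b : Fin n} (ab : Adj H a b) where

    a≢b : ¬ a ≡ b
    a≢b = adj⇒≢ ab

    blockPath-TT : ∀ u₀ v₀ → ¬ u₀ ≡ v₀ → BlockPath (true , u₀) (true , v₀)
    blockPath-TT u₀ v₀ u₀≢v₀ with others-align 0 0 (unique₂ u₀≢v₀) (unique₂ a≢b) refl (Unique-length≤ (unique₂ a≢b))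
    ... | [] , [] , xs , ys , split , split′ , len = blockPath σ enumeration
      where
      σ = (true , u₀) ∷⟨ tt ⟩ (false , a) ∷⟨ ab ⟩ zigzag false b xs ys ++⟨ tt ⟩ trivial
      enumeration = tagged-others [] xs [] ys (unique₂ u₀≢v₀) (unique₂ a≢b) split split′
        (↭-trans (zoom (⊤[ u₀ ] ++ ⊥[ a ] ++ ⊥[ b ]) (zig-↭ false xs ys len))
                 (solve 6 (λ u v a b X Y → (u ⊕ (a ⊕ b)) ⊕ ((X ⊕ Y) ⊕ v) ⊜ (u ⊕ (v ⊕ X)) ⊕ (a ⊕ (b ⊕ Y)))
                        ↭-refl ⊤[ u₀ ] ⊤[ v₀ ] ⊥[ a ] ⊥[ b ] (⊤* xs) (⊥* ys)))

    blockPath₁-FF : ∀ u₀ v₀ → ¬ u₀ ≡ v₀ → BlockPath₁ (false , u₀) (false , v₀)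
    blockPath₁-FF u₀ v₀ u₀≢v₀ with others-align 0 0 (unique₂ a≢b) (unique₂ u₀≢v₀) refl (Unique-length≤ (unique₂ a≢b))
    ... | [] , [] , ys , xs , split , split′ , len = blockPath₁ first second enumeration
      where
      first  = (false , u₀) ∷⟨ tt ⟩ zigzag true a xs ys
      second = (true , b) ∷⟨ tt ⟩ trivial {u = false , v₀}
      enumeration = tagged-others [] ys [] xs (unique₂ a≢b) (unique₂ u₀≢v₀) split split′
        (↭-trans (zoom (⊥[ u₀ ] ++ ⊤[ a ]) (zig-↭ true xs ys (sym len)))
                 (solve 6 (λ u v a b X Y → (u ⊕ a) ⊕ ((X ⊕ Y) ⊕ (b ⊕ v)) ⊜ (a ⊕ (b ⊕ Y)) ⊕ (u ⊕ (v ⊕ X)))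
                        ↭-refl ⊥[ u₀ ] ⊥[ v₀ ] ⊤[ a ] ⊤[ b ] (⊥* xs) (⊤* ys)))

    blockPath₁-TF : ∀ u₀ v₀ → ¬ a ≡ v₀ → ¬ b ≡ v₀ → BlockPath₁ (true , u₀) (false , v₀)
    blockPath₁-TF u₀ v₀ a≢v₀ b≢v₀
      with others-align 2 0 (unique₁ u₀) (unique₃ a≢b a≢v₀ b≢v₀) refl (Unique-length≤ (unique₃ a≢b a≢v₀ b≢v₀))
    ... | p₁ ∷ p₂ ∷ [] , [] , ps , ys , split , split′ , len = blockPath₁ trivial second enumeration
      where
      second = (true , p₁) ∷⟨ tt ⟩ (false , a) ∷⟨ ab ⟩ zigzag false b ps ys ++⟨ tt ⟩ (true , p₂) ∷⟨ tt ⟩ trivial {u = false , v₀}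
      enumeration = tagged-others (p₁ ∷ p₂ ∷ []) ps [] ys (unique₁ u₀) (unique₃ a≢b a≢v₀ b≢v₀) split split′
        (↭-trans (zoom (⊤[ u₀ ] ++ ⊤[ p₁ ] ++ ⊥[ a ] ++ ⊥[ b ]) (zig-↭ false ps ys len))
                 (solve 8 (λ u p q a b v P Y → (u ⊕ (p ⊕ (a ⊕ b))) ⊕ ((P ⊕ Y) ⊕ (q ⊕ v))
                                              ⊜ (u ⊕ (p ⊕ (q ⊕ P))) ⊕ (a ⊕ (b ⊕ (v ⊕ Y))))
                        ↭-refl ⊤[ u₀ ] ⊤[ p₁ ] ⊤[ p₂ ] ⊥[ a ] ⊥[ b ] ⊥[ v₀ ] (⊤* ps) (⊥* ys)))

    blockPath₂-TT : ∀ u₀ v₀ → ¬ u₀ ≡ v₀ → 3 ≤ n → BlockPath₂ (true , u₀) (true , v₀)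
    blockPath₂-TT u₀ v₀ u₀≢v₀ n≥3 with others-align 1 1 (unique₂ u₀≢v₀) (unique₂ a≢b) refl n≥3
    ... | x₁ ∷ [] , y₁ ∷ [] , xs , ys , split , split′ , len = blockPath₂ trivial second third enumeration
      where
      second = zigzag true x₁ ys xs ++⟨ tt ⟩ trivial {u = false , y₁}
      third  = (false , a) ∷⟨ ab ⟩ (false , b) ∷⟨ tt ⟩ trivial {u = true , v₀}
      enumeration = tagged-others (x₁ ∷ []) xs (y₁ ∷ []) ys (unique₂ u₀≢v₀) (unique₂ a≢b) split split′
        (↭-trans (++⁺ˡ (⊤[ u₀ ] ++ ⊤[ x₁ ]) (++⁺ʳ (⊥[ a ] ++ ⊥[ b ] ++ ⊤[ v₀ ]) (++⁺ʳ ⊥[ y₁ ] (zig-↭ true ys xs (sym len)))))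
                 (solve 8 (λ u v x y a b X Y → (u ⊕ x) ⊕ (((Y ⊕ X) ⊕ y) ⊕ (a ⊕ (b ⊕ v)))
                                              ⊜ (u ⊕ (v ⊕ (x ⊕ X))) ⊕ (a ⊕ (b ⊕ (y ⊕ Y))))
                        ↭-refl ⊤[ u₀ ] ⊤[ v₀ ] ⊤[ x₁ ] ⊥[ y₁ ] ⊥[ a ] ⊥[ b ] (⊤* xs) (⊥* ys)))

    blockPath₂-FF : ∀ u₀ v₀ → ¬ u₀ ≡ v₀ → 3 ≤ n → BlockPath₂ (false , u₀) (false , v₀)
    blockPath₂-FF u₀ v₀ u₀≢v₀ n≥3 with others-align 1 1 (unique₂ a≢b) (unique₂ u₀≢v₀) refl n≥3
    ... | x₁ ∷ [] , y₁ ∷ [] , xs , ys , split , split′ , len = blockPath₂ first second trivial enumeration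
      where
      first  = (false , u₀) ∷⟨ tt ⟩ (true , a) ∷⟨ ab ⟩ trivial {u = true , b}
      second = zigzag true x₁ ys xs ++⟨ tt ⟩ trivial {u = false , y₁}
      enumeration = tagged-others (x₁ ∷ []) xs (y₁ ∷ []) ys (unique₂ a≢b) (unique₂ u₀≢v₀) split split′
        (↭-trans (++⁺ˡ (⊥[ u₀ ] ++ ⊤[ a ] ++ ⊤[ b ] ++ ⊤[ x₁ ]) (++⁺ʳ ⊥[ v₀ ] (++⁺ʳ ⊥[ y₁ ] (zig-↭ true ys xs (sym len)))))
                 (solve 8 (λ u v x y a b X Y → (u ⊕ (a ⊕ (b ⊕ x))) ⊕ (((Y ⊕ X) ⊕ y) ⊕ v)
                                              ⊜ (a ⊕ (b ⊕ (x ⊕ X))) ⊕ (u ⊕ (v ⊕ (y ⊕ Y))))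
                        ↭-refl ⊥[ u₀ ] ⊥[ v₀ ] ⊤[ x₁ ] ⊥[ y₁ ] ⊤[ a ] ⊤[ b ] (⊤* xs) (⊥* ys)))

  blockPath₂-TF : ∀ u₀ v₀ → 2 ≤ n → BlockPath₂ (true , u₀) (false , v₀)
  blockPath₂-TF u₀ v₀ n≥2 with others-align 1 1 (unique₁ u₀) (unique₁ v₀) refl n≥2
  ... | x₁ ∷ [] , y₁ ∷ [] , xs , ys , split , split′ , len = blockPath₂ trivial second trivial enumeration
    where
    second = zigzag true x₁ ys xs ++⟨ tt ⟩ trivial {u = false , y₁}
    enumeration = tagged-others (x₁ ∷ []) xs (y₁ ∷ []) ys (unique₁ u₀) (unique₁ v₀) split split′
      (↭-trans (++⁺ˡ (⊤[ u₀ ] ++ ⊤[ x₁ ]) (++⁺ʳ ⊥[ v₀ ] (++⁺ʳ ⊥[ y₁ ] (zig-↭ true ys xs (sym len)))))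
               (solve 6 (λ u v x y X Y → (u ⊕ x) ⊕ (((Y ⊕ X) ⊕ y) ⊕ v) ⊜ (u ⊕ (x ⊕ X)) ⊕ (v ⊕ (y ⊕ Y)))
                      ↭-refl ⊤[ u₀ ] ⊥[ v₀ ] ⊤[ x₁ ] ⊥[ y₁ ] (⊤* xs) (⊥* ys)))

  data TwoEdges : Set where
    path₃    : ∀ {a b c} → Unique (a ∷ b ∷ c ∷ []) → Adj H a b → Adj H b c → TwoEdges
    matching : ∀ {a b c d} → Unique (a ∷ b ∷ c ∷ d ∷ []) → Adj H a b → Adj H c d → TwoEdges

  blockPath₁-TT : TwoEdges → ∀ u₀ v₀ → ¬ u₀ ≡ v₀ → BlockPath₁ (true , u₀) (true , v₀)
  blockPath₁-TT (path₃ {a} {b} {c} uS′ ab bc) u₀ v₀ u₀≢v₀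
    with others-align 1 0 (unique₂ u₀≢v₀) uS′ refl (Unique-length≤ uS′)
  ... | x₁ ∷ [] , [] , xs , ys , split , split′ , len = blockPath₁ trivial second enumeration
    where
    second = (true , x₁) ∷⟨ tt ⟩ (false , a) ∷⟨ ab ⟩ (false , b) ∷⟨ bc ⟩ zigzag false c xs ys ++⟨ tt ⟩ trivial {u = true , v₀}
    enumeration = tagged-others (x₁ ∷ []) xs [] ys (unique₂ u₀≢v₀) uS′ split split′
      (↭-trans (zoom (⊤[ u₀ ] ++ ⊤[ x₁ ] ++ ⊥[ a ] ++ ⊥[ b ] ++ ⊥[ c ]) (zig-↭ false xs ys len))
               (solve 8 (λ u v x a b c X Y → (u ⊕ (x ⊕ (a ⊕ (b ⊕ c)))) ⊕ ((X ⊕ Y) ⊕ v)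
                                            ⊜ (u ⊕ (v ⊕ (x ⊕ X))) ⊕ (a ⊕ (b ⊕ (c ⊕ Y))))
                      ↭-refl ⊤[ u₀ ] ⊤[ v₀ ] ⊤[ x₁ ] ⊥[ a ] ⊥[ b ] ⊥[ c ] (⊤* xs) (⊥* ys)))
  blockPath₁-TT (matching {a} {b} {c} {d} uS′ ab cd) u₀ v₀ u₀≢v₀
    with others-align 2 0 (unique₂ u₀≢v₀) uS′ refl (Unique-length≤ uS′)
  ... | x₁ ∷ x₂ ∷ [] , [] , xs , ys , split , split′ , len = blockPath₁ trivial second enumeration
    where
    second = (true , x₁) ∷⟨ tt ⟩ (false , a) ∷⟨ ab ⟩ (false , b) ∷⟨ tt ⟩ (true , x₂) ∷⟨ tt ⟩ (false , c) ∷⟨ cd ⟩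
             zigzag false d xs ys ++⟨ tt ⟩ trivial {u = true , v₀}
    enumeration = tagged-others (x₁ ∷ x₂ ∷ []) xs [] ys (unique₂ u₀≢v₀) uS′ split split′
      (↭-trans (zoom (⊤[ u₀ ] ++ ⊤[ x₁ ] ++ ⊥[ a ] ++ ⊥[ b ] ++ ⊤[ x₂ ] ++ ⊥[ c ] ++ ⊥[ d ]) (zig-↭ false xs ys len))
               (solve 10 (λ u v x y a b c d X Y → (u ⊕ (x ⊕ (a ⊕ (b ⊕ (y ⊕ (c ⊕ d)))))) ⊕ ((X ⊕ Y) ⊕ v)
                                                ⊜ (u ⊕ (v ⊕ (x ⊕ (y ⊕ X)))) ⊕ (a ⊕ (b ⊕ (c ⊕ (d ⊕ Y)))))
                      ↭-refl ⊤[ u₀ ] ⊤[ v₀ ] ⊤[ x₁ ] ⊤[ x₂ ] ⊥[ a ] ⊥[ b ] ⊥[ c ] ⊥[ d ] (⊤* xs) (⊥* ys)))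

  TwoEdges-edge : TwoEdges → ∃₂ λ a b → Adj H a b
  TwoEdges-edge (path₃ _ ab _)    = _ , _ , ab
  TwoEdges-edge (matching _ ab _) = _ , _ , ab

  TwoEdges-3≤n : TwoEdges → 3 ≤ n
  TwoEdges-3≤n (path₃ uS _ _)    = Unique-length≤ uS
  TwoEdges-3≤n (matching uS _ _) = ≤-trans (n≤1+n 3) (Unique-length≤ uS)

Interval : ℕ → ℕ → ℕ → Set
Interval lo hi i = lo ≤ i × i < hi

Interval-empty : ∀ {lo i} → ¬ Interval lo lo i
Interval-empty (lo≤i , i<lo) = <-irrefl refl (<-≤-trans i<lo lo≤i)

Interval-split : ∀ {lo mid hi} → lo ≤ mid → mid ≤ hi → Interval lo hi ≐ Interval lo mid ∪ Interval mid hi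
Interval-split {mid = mid} lo≤mid mid≤hi = split , join
  where
  split : Interval _ _ ⊆ Interval _ _ ∪ Interval _ _
  split {i} (lo≤i , i<hi) with i <? mid
  ... | yes i<mid = inj₁ (lo≤i , i<mid)
  ... | no  i≮mid = inj₂ (≮⇒≥ i≮mid , i<hi)
  join : Interval _ _ ∪ Interval _ _ ⊆ Interval _ _
  join (inj₁ (lo≤i , i<mid)) = lo≤i , <-≤-trans i<mid mid≤hi
  join (inj₂ (mid≤i , i<hi)) = ≤-trans lo≤mid mid≤i , i<hi

Interval-disjoint : ∀ {lo mid mid′ hi} → mid ≤ mid′ → Interval lo mid ⊆ ∁ (Interval mid′ hi)
Interval-disjoint mid≤mid′ (_ , i<mid) (mid′≤i , _) = <-irrefl refl (<-≤-trans i<mid (≤-trans mid≤mid′ mid′≤i))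

Window : ℕ → ℕ → ℕ → Set
Window lo k = Interval lo (lo + 2 * k)

Window-+ : ∀ lo a r → Window lo (a + r) ≐ Window lo a ∪ Window (lo + 2 * a) r
Window-+ lo a r = subst (λ hi → Interval lo hi ≐ Window lo a ∪ Window (lo + 2 * a) r) (regroup lo a r)
                        (Interval-split (m≤m+n lo (2 * a)) (m≤m+n (lo + 2 * a) (2 * r)))
  where
  regroup : ∀ lo a r → lo + 2 * a + 2 * r ≡ lo + 2 * (a + r)
  regroup = solve-∀

Window-empty : ∀ {lo i} → ¬ Window lo 0 i
Window-empty {lo} {i} = Interval-empty ∘ subst (λ hi → Interval lo hi i) (+-identityʳ lo)

Window-pair : ∀ B → Window B 1 ≐ (λ i → i ≡ B ⊎ i ≡ suc B)
Window-pair B = pair , unpair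
  where
  B+2≡ : B + 2 * 1 ≡ suc (suc B)
  B+2≡ = +-comm B 2
  pair : Window B 1 ⊆ (λ i → i ≡ B ⊎ i ≡ suc B)
  pair {i} (B≤i , i<B+2) with m≤n⇒m<n∨m≡n B≤i | m≤n⇒m<n∨m≡n (≤-pred (subst (i <_) B+2≡ i<B+2))
  ... | inj₂ refl | _          = inj₁ refl
  ... | inj₁ _    | inj₂ refl  = inj₂ refl
  ... | inj₁ B<i  | inj₁ i<1+B = ⊥-elim (<-irrefl refl (<-≤-trans i<1+B B<i))
  unpair : (λ i → i ≡ B ⊎ i ≡ suc B) ⊆ Window B 1
  unpair (inj₁ refl) = ≤-refl , subst (B <_) (sym B+2≡) (<-trans (n<1+n B) (n<1+n (suc B)))
  unpair (inj₂ refl) = n≤1+n B , subst (suc B <_) (sym B+2≡) (n<1+n (suc B))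

Window-around : ∀ lo a r → Window lo (a + suc r) ≐ Window (lo + 2 * a) 1 ∪ (Window lo a ∪ Window (lo + 2 * a + 2) r)
Window-around lo a r =
  ≐-trans (Window-+ lo a (suc r)) (≐-trans (∪-cong ≐-refl (Window-+ (lo + 2 * a) 1 r)) ∪-middle)

next-block : ∀ lo a → suc (suc (lo + 2 * a)) ≡ lo + 2 * suc a
next-block = solve-∀

Window-first : ∀ lo r → Window lo (suc r) lo
Window-first lo r = ≤-refl , m<m+n lo (s≤s z≤n)

Window-lastBlock : ∀ lo a → Window (lo + 2 * a) 1 ⊆ Window lo (suc a)
Window-lastBlock lo a {i} i∈ = subst (λ k → Window lo k i) (+-comm a 1) (proj₂ (Window-+ lo a 1) (inj₂ i∈))

Window-last : ∀ lo a → Window lo (suc a) (suc (lo + 2 * a))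
Window-last lo a = Window-lastBlock lo a (proj₂ (Window-pair (lo + 2 * a)) (inj₂ refl))

Window-block : ∀ lo k {i} → Window lo k i → ∃₂ λ a r → k ≡ a + suc r × Window (lo + 2 * a) 1 i
Window-block lo zero    i∈ = ⊥-elim (Window-empty i∈)
Window-block lo (suc k) {i} (lo≤i , i<) with i <? lo + 2
... | yes i<lo+2 = 0 , k , refl , subst (_≤ i) (sym (+-identityʳ lo)) lo≤i , subst (i <_) (regroup₀ lo) i<lo+2
  where
  regroup₀ : ∀ lo → lo + 2 ≡ lo + 2 * 0 + 2 * 1
  regroup₀ = solve-∀
... | no  i≮lo+2 with Window-block (lo + 2) k (≮⇒≥ i≮lo+2 , subst (i <_) (regroup₁ lo k) i<)
  where
  regroup₁ : ∀ lo k → lo + 2 * suc k ≡ lo + 2 + 2 * k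
  regroup₁ = solve-∀
...   | a , r , refl , i∈block = suc a , r , refl , subst (λ B → Window B 1 i) (regroup₂ lo a) i∈block
  where
  regroup₂ : ∀ lo a → lo + 2 + 2 * a ≡ lo + 2 * suc a
  regroup₂ = solve-∀

earlier-block-not-last : ∀ {a a′ r′} → a < a′ → ¬ a + 1 ≡ a′ + suc r′
earlier-block-not-last {a} {a′} {r′} a<a′ eq = <-irrefl eq (begin-strict
  a + 1       ≡⟨ +-comm a 1 ⟩
  suc a       ≤⟨ a<a′ ⟩
  a′          <⟨ m<m+n a′ (s≤s z≤n) ⟩
  a′ + suc r′ ∎)
  where open ≤-Reasoning

module Connectivity {n : ℕ} (H : Graph (Fin n)) where

  open Layered H
  open TwoLayers H
  open Constructions H

  on-layers : ∀ {P Q : ℕ → Set} → P ≐ Q → (λ (x : W) → P (proj₁ x)) ≐ (λ x → Q (proj₁ x))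
  on-layers (P⊆Q , Q⊆P) = P⊆Q , Q⊆P

  InLayers-swap : ∀ {L₁ L₂} → InLayers L₂ L₁ ≐ InLayers L₁ L₂
  InLayers-swap = Data.Sum.swap , Data.Sum.swap

  module _ {a b : Fin n} (ab : Adj H a b) where

    block-connected : ∀ {L₁ L₂} → LayerAdj L₁ L₂ → ∀ u v → InLayers L₁ L₂ u → InLayers L₁ L₂ v → ¬ u ≡ v →
                      HamiltonianPath (InLayers L₁ L₂) u v
    block-connected L₁L₂ (_ , u₀) (_ , v₀) (inj₁ refl) (inj₁ refl) u≢v =
      Block.blockPath⇒hamiltonianPath _ _ L₁L₂ (blockPath-TT ab u₀ v₀ (u≢v ∘ cong (_ ,_)))
    block-connected L₁L₂ (_ , u₀) (_ , v₀) (inj₁ refl) (inj₂ refl) _ =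
      Block.blockPath⇒hamiltonianPath _ _ L₁L₂ (blockPath-TF u₀ v₀)
    block-connected L₁L₂ (_ , u₀) (_ , v₀) (inj₂ refl) (inj₁ refl) _ =
      HamiltonianPath-reverse (Block.blockPath⇒hamiltonianPath _ _ L₁L₂ (blockPath-TF v₀ u₀))
    block-connected L₁L₂ (_ , u₀) (_ , v₀) (inj₂ refl) (inj₂ refl) u≢v =
      HamiltonianPath-resp InLayers-swap
        (Block.blockPath⇒hamiltonianPath _ _ (LayerAdj-sym L₁L₂) (blockPath-TT ab u₀ v₀ (u≢v ∘ cong (_ ,_))))

    module _ {L₁ L₂ P : ℕ} {O : W → Set} {c d : Fin n} (TE : TwoEdges) (L₁L₂ : LayerAdj L₁ L₂) (L₁P : LayerAdj L₁ P)
             (O⊥block : O ⊆ ∁ (InLayers L₁ L₂)) (detour : HamiltonianPath O (P , c) (P , d)) where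

      open Block L₁ L₂ L₁L₂

      private
        detoured : ∀ {s t} → BlockPath₁ s t → HamiltonianPath (InLayers L₁ L₂ ∪ O) (embed s) (embed t)
        detoured = blockPath₁⇒hamiltonianPath L₁P O⊥block detour

        across : ∀ u₀ v₀ → HamiltonianPath (InLayers L₁ L₂ ∪ O) (L₁ , u₀) (L₂ , v₀)
        across u₀ v₀ with v₀ Fin.≟ b | v₀ Fin.≟ a
        ... | yes refl | _        = detoured (blockPath₁-TF-edge u₀ ab)
        ... | no _     | yes refl = detoured (blockPath₁-TF-edge u₀ (Graph.sym H ab))
        ... | no v₀≢b  | no v₀≢a  = detoured (blockPath₁-TF ab u₀ v₀ (v₀≢a ∘ sym) (v₀≢b ∘ sym))

      oneSide-connected : ∀ u v → InLayers L₁ L₂ u → InLayers L₁ L₂ v → ¬ u ≡ v → HamiltonianPath (InLayers L₁ L₂ ∪ O) u v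
      oneSide-connected (_ , u₀) (_ , v₀) (inj₁ refl) (inj₁ refl) u≢v = detoured (blockPath₁-TT TE u₀ v₀ (u≢v ∘ cong (_ ,_)))
      oneSide-connected (_ , u₀) (_ , v₀) (inj₁ refl) (inj₂ refl) _   = across u₀ v₀
      oneSide-connected (_ , u₀) (_ , v₀) (inj₂ refl) (inj₁ refl) _   = HamiltonianPath-reverse (across v₀ u₀)
      oneSide-connected (_ , u₀) (_ , v₀) (inj₂ refl) (inj₂ refl) u≢v = detoured (blockPath₁-FF ab u₀ v₀ (u≢v ∘ cong (_ ,_)))

    module _ {L₁ L₂ P Q : ℕ} {OL OR : W → Set} {c d c′ d′ : Fin n} (n≥3 : 3 ≤ n)
             (L₁L₂ : LayerAdj L₁ L₂) (L₁P : LayerAdj L₁ P) (L₂Q : LayerAdj L₂ Q)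
             (OL⊥block : OL ⊆ ∁ (InLayers L₁ L₂)) (OR⊥block : OR ⊆ ∁ (InLayers L₁ L₂)) (OL⊥OR : OL ⊆ ∁ OR)
             (detourL : HamiltonianPath OL (P , c) (P , d)) (detourR : HamiltonianPath OR (Q , c′) (Q , d′)) where

      open Block L₁ L₂ L₁L₂

      private
        detoured : ∀ {s t} → BlockPath₂ s t → HamiltonianPath (InLayers L₁ L₂ ∪ (OL ∪ OR)) (embed s) (embed t)
        detoured = blockPath₂⇒hamiltonianPath L₁P L₂Q OL⊥block OR⊥block OL⊥OR detourL detourR

      twoSide-connected : ∀ u v → InLayers L₁ L₂ u → InLayers L₁ L₂ v → ¬ u ≡ v →
                          HamiltonianPath (InLayers L₁ L₂ ∪ (OL ∪ OR)) u v
      twoSide-connected (_ , u₀) (_ , v₀) (inj₁ refl) (inj₁ refl) u≢v = detoured (blockPath₂-TT ab u₀ v₀ (u≢v ∘ cong (_ ,_)) n≥3)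
      twoSide-connected (_ , u₀) (_ , v₀) (inj₁ refl) (inj₂ refl) _   = detoured (blockPath₂-TF u₀ v₀ (≤-trans (s≤s (s≤s z≤n)) n≥3))
      twoSide-connected (_ , u₀) (_ , v₀) (inj₂ refl) (inj₁ refl) _   =
        HamiltonianPath-reverse (detoured (blockPath₂-TF v₀ u₀ (≤-trans (s≤s (s≤s z≤n)) n≥3)))
      twoSide-connected (_ , u₀) (_ , v₀) (inj₂ refl) (inj₂ refl) u≢v = detoured (blockPath₂-FF ab u₀ v₀ (u≢v ∘ cong (_ ,_)) n≥3)

  InWindow : ℕ → ℕ → W → Set
  InWindow lo k x = Window lo k (proj₁ x)

  WindowConnected : ℕ → ℕ → Set
  WindowConnected lo k = ∀ u v → InWindow lo k u → InWindow lo k v → ¬ u ≡ v → HamiltonianPath (InWindow lo k) u v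

  InLayers≐Window : ∀ B → InLayers B (suc B) ≐ InWindow B 1
  InLayers≐Window B = on-layers (≐-sym (Window-pair B))

  window₁-connected : ∀ {a b} → Adj H a b → ∀ lo → WindowConnected lo 1
  window₁-connected ab lo u v u∈ v∈ u≢v =
    HamiltonianPath-resp (InLayers≐Window lo)
      (block-connected ab (inj₁ refl) u v (proj₂ (InLayers≐Window lo) {u} u∈) (proj₂ (InLayers≐Window lo) {v} v∈) u≢v)

  module Step (TE : TwoEdges) {e₁ e₂ : Fin n} (e : Adj H e₁ e₂) {k : ℕ} (k≥2 : 2 ≤ k)
              (IH : ∀ {k′} → k′ < k → 1 ≤ k′ → ∀ lo → WindowConnected lo k′) where

    private
      other : ∀ h → ∃ λ c → ¬ c ≡ h
      other h with h Fin.≟ e₁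
      ... | yes refl = e₂ , adj⇒≢ e ∘ sym
      ... | no  h≢e₁  = e₁ , h≢e₁ ∘ sym

      detour : ∀ {k′} lo → k′ < k → 1 ≤ k′ → ∀ {L} → Window lo k′ L → HamiltonianPath (InWindow lo k′) (L , e₁) (L , e₂)
      detour lo k′<k k′≥1 L∈ = IH k′<k k′≥1 lo _ _ L∈ L∈ (adj⇒≢ e ∘ cong proj₂)

    split : ∀ lo {u v a r a′ r′} → InWindow lo k v → k ≡ a + suc r → Window (lo + 2 * a) 1 (proj₁ u) →
            k ≡ a′ + suc r′ → Window (lo + 2 * a′) 1 (proj₁ v) → a < a′ → HamiltonianPath (InWindow lo k) u v
    split lo {u} {v} {a} {zero} v∈ refl _ k≡′ _ a<a′ = ⊥-elim (earlier-block-not-last a<a′ k≡′)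
    split lo {u} {v} {a} {suc r₀} v∈ refl u∈block _ v∈block a<a′ =
      HamiltonianPath-resp halves
        (join (Interval-disjoint ≤-refl) (IH left<k (s≤s z≤n) lo u (L , c) u∈left (Window-last lo a) (c≢u ∘ sym ∘ cong proj₂))
              (inj₁ (inj₁ (next-block lo a)))
              (IH right<k (s≤s z≤n) F (F , c′) v (Window-first F r₀) v∈right (c′≢v ∘ cong proj₂)))
      where
      r = suc r₀
      L = suc (lo + 2 * a)
      F = lo + 2 * suc a
      c = proj₁ (other (proj₂ u))
      c≢u = proj₂ (other (proj₂ u))
      c′ = proj₁ (other (proj₂ v))
      c′≢v = proj₂ (other (proj₂ v))
      k≡ : a + suc r ≡ suc a + r
      k≡ = +-suc a r
      left<k : suc a < a + suc r
      left<k = subst (suc a <_) (sym k≡) (m<m+n (suc a) (s≤s z≤n))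
      right<k : r < a + suc r
      right<k = ≤-trans (n<1+n r) (m≤n+m (suc r) a)
      halves : InWindow lo (suc a) ∪ InWindow F r ≐ InWindow lo (a + suc r)
      halves = on-layers (≐-sym (subst (λ K → Window lo K ≐ Window lo (suc a) ∪ Window F r) (sym k≡) (Window-+ lo (suc a) r)))
      u∈left : InWindow lo (suc a) u
      u∈left = Window-lastBlock lo a u∈block
      v∈right : InWindow F r v
      v∈right with proj₂ halves {v} v∈
      ... | inj₁ v∈left  = ⊥-elim (Interval-disjoint (+-monoʳ-≤ lo (*-monoʳ-≤ 2 a<a′)) v∈left v∈block)
      ... | inj₂ v∈right = v∈right

    -- Here the upper layer of the block faces the rest of the window, so it is the one tagged true.
    firstBlock : ∀ r₀ → k ≡ zero + suc (suc r₀) → ∀ lo {u v} → Window (lo + 2 * zero) 1 (proj₁ u) →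
                 Window (lo + 2 * zero) 1 (proj₁ v) → ¬ u ≡ v → HamiltonianPath (InWindow lo k) u v
    firstBlock r₀ refl lo {u} {v} u∈ v∈ u≢v =
      HamiltonianPath-resp decomposition
        (oneSide-connected e {suc B} {B} {B + 2} {InWindow (B + 2) (suc r₀)} TE (inj₂ refl) (inj₁ (sym (+-comm B 2))) (λ {x} → O⊥block {x})
          (detour (B + 2) (n<1+n (suc r₀)) (s≤s z≤n) (Window-first (B + 2) r₀))
          u v (proj₂ block≐ {u} u∈) (proj₂ block≐ {v} v∈) u≢v)
      where
      B = lo + 2 * zero
      block≐ : InLayers (suc B) B ≐ InWindow B 1
      block≐ = ≐-trans InLayers-swap (InLayers≐Window B)
      O⊥block : InWindow (B + 2) (suc r₀) ⊆ ∁ (InLayers (suc B) B)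
      O⊥block {x} x∈O x∈block = Interval-disjoint ≤-refl (proj₁ block≐ {x} x∈block) x∈O
      decomposition : InLayers (suc B) B ∪ InWindow (B + 2) (suc r₀) ≐ InWindow lo (zero + suc (suc r₀))
      decomposition = ≐-trans (∪-cong block≐ right≐) (on-layers (≐-sym (Window-around lo zero (suc r₀))))
        where
        right≐ : InWindow (B + 2) (suc r₀) ≐ InWindow lo zero ∪ InWindow (B + 2) (suc r₀)
        right≐ = ≐-sym (∪-emptyˡ (λ {x} → Window-empty {lo} {proj₁ x}))

    lastBlock : ∀ a₀ → k ≡ suc a₀ + 1 → ∀ lo {u v} → Window (lo + 2 * suc a₀) 1 (proj₁ u) →
                Window (lo + 2 * suc a₀) 1 (proj₁ v) → ¬ u ≡ v → HamiltonianPath (InWindow lo k) u v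
    lastBlock a₀ refl lo {u} {v} u∈ v∈ u≢v =
      HamiltonianPath-resp decomposition
        (oneSide-connected e {B} {suc B} {P} {InWindow lo a} TE (inj₁ refl) (inj₂ (next-block lo a₀)) (λ {x} → O⊥block {x})
          (detour lo (m<m+n a (s≤s z≤n)) (s≤s z≤n) (Window-last lo a₀))
          u v (proj₂ (InLayers≐Window B) {u} u∈) (proj₂ (InLayers≐Window B) {v} v∈) u≢v)
      where
      a = suc a₀
      B = lo + 2 * a
      P = suc (lo + 2 * a₀)
      O⊥block : InWindow lo a ⊆ ∁ (InLayers B (suc B))
      O⊥block {x} x∈O x∈block = Interval-disjoint ≤-refl x∈O (proj₁ (InLayers≐Window B) {x} x∈block)
      decomposition : InLayers B (suc B) ∪ InWindow lo a ≐ InWindow lo (a + 1)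
      decomposition = ≐-trans (∪-cong (InLayers≐Window B) left≐) (on-layers (≐-sym (Window-around lo a zero)))
        where
        left≐ : InWindow lo a ≐ InWindow lo a ∪ InWindow (B + 2) zero
        left≐ = ≐-sym (∪-emptyʳ (λ {x} → Window-empty {B + 2} {proj₁ x}))

    innerBlock : ∀ a₀ r₀ → k ≡ suc a₀ + suc (suc r₀) → ∀ lo {u v} → Window (lo + 2 * suc a₀) 1 (proj₁ u) →
                 Window (lo + 2 * suc a₀) 1 (proj₁ v) → ¬ u ≡ v → HamiltonianPath (InWindow lo k) u v
    innerBlock a₀ r₀ refl lo {u} {v} u∈ v∈ u≢v =
      HamiltonianPath-resp decomposition
        (twoSide-connected e {B} {suc B} {P} {B + 2} {InWindow lo a} {InWindow (B + 2) r} (TwoEdges-3≤n TE)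
          (inj₁ refl) (inj₂ (next-block lo a₀)) (inj₁ (sym (+-comm B 2)))
          (λ {x} → OL⊥block {x}) (λ {x} → OR⊥block {x}) (λ {x} → Interval-disjoint (m≤m+n B 2))
          (detour lo a<k (s≤s z≤n) (Window-last lo a₀)) (detour (B + 2) r<k (s≤s z≤n) (Window-first (B + 2) r₀))
          u v (proj₂ (InLayers≐Window B) {u} u∈) (proj₂ (InLayers≐Window B) {v} v∈) u≢v)
      where
      a = suc a₀
      r = suc r₀
      B = lo + 2 * a
      P = suc (lo + 2 * a₀)
      a<k : a < a + suc r
      a<k = m<m+n a (s≤s z≤n)
      r<k : r < a + suc r
      r<k = ≤-trans (n<1+n r) (m≤n+m (suc r) a)
      OL⊥block : InWindow lo a ⊆ ∁ (InLayers B (suc B))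
      OL⊥block {x} x∈O x∈block = Interval-disjoint ≤-refl x∈O (proj₁ (InLayers≐Window B) {x} x∈block)
      OR⊥block : InWindow (B + 2) r ⊆ ∁ (InLayers B (suc B))
      OR⊥block {x} x∈O x∈block = Interval-disjoint ≤-refl (proj₁ (InLayers≐Window B) {x} x∈block) x∈O
      decomposition : InLayers B (suc B) ∪ (InWindow lo a ∪ InWindow (B + 2) r) ≐ InWindow lo (a + suc r)
      decomposition = ≐-trans (∪-cong (InLayers≐Window B) ≐-refl) (on-layers (≐-sym (Window-around lo a r)))

    sameBlock : ∀ lo {u v a r} → k ≡ a + suc r → Window (lo + 2 * a) 1 (proj₁ u) → Window (lo + 2 * a) 1 (proj₁ v) →
                ¬ u ≡ v → HamiltonianPath (InWindow lo k) u v
    sameBlock lo {a = zero}   {zero}   refl _ _ _ = ⊥-elim (2≰1 k≥2)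
      where
      2≰1 : ¬ 2 ≤ 1
      2≰1 (s≤s ())
    sameBlock lo {a = zero}   {suc r₀} k≡ = firstBlock r₀ k≡ lo
    sameBlock lo {a = suc a₀} {zero}   k≡ = lastBlock a₀ k≡ lo
    sameBlock lo {a = suc a₀} {suc r₀} k≡ = innerBlock a₀ r₀ k≡ lo

    step : ∀ lo → WindowConnected lo k
    step lo u v u∈ v∈ u≢v with Window-block lo k u∈ | Window-block lo k v∈
    ... | a , r , k≡ , u∈block | a′ , r′ , k≡′ , v∈block with <-cmp a a′
    ... | tri< a<a′ _ _ = split lo v∈ k≡ u∈block k≡′ v∈block a<a′
    ... | tri> _ _ a′<a = HamiltonianPath-reverse (split lo u∈ k≡′ v∈block k≡ u∈block a′<a)
    ... | tri≈ _ refl _ = sameBlock lo k≡ u∈block v∈block u≢v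

  window-connected : TwoEdges → ∀ k → 1 ≤ k → ∀ lo → WindowConnected lo k
  window-connected TE = <-rec (λ k → 1 ≤ k → ∀ lo → WindowConnected lo k) connected
    where
    connected : ∀ k → (∀ {k′} → k′ < k → 1 ≤ k′ → ∀ lo → WindowConnected lo k′) → 1 ≤ k → ∀ lo → WindowConnected lo k
    connected 1             _  _ = window₁-connected (proj₂ (proj₂ (TwoEdges-edge TE)))
    connected (suc (suc k)) IH _ = Step.step TE (proj₂ (proj₂ (TwoEdges-edge TE))) (s≤s (s≤s z≤n)) IH

module Transfer {n : ℕ} (H : Graph (Fin n)) (m : ℕ) where

  open Layered H

  toW : Fin m × Fin n → W
  toW (g , h) = toℕ g , h

  toW-injective : ∀ {x y} → toW x ≡ toW y → x ≡ y
  toW-injective {_ , _} {_ , _} e with toℕ-injective (cong proj₁ e) | cong proj₂ e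
  ... | refl | refl = refl

  fromW : (xs : List W) → All (λ x → proj₁ x < m) xs → List (Fin m × Fin n)
  fromW []       []       = []
  fromW (x ∷ xs) (b ∷ bs) = (fromℕ< b , proj₂ x) ∷ fromW xs bs

  map-toW-fromW : ∀ xs bs → map toW (fromW xs bs) ≡ xs
  map-toW-fromW []       []       = refl
  map-toW-fromW (x ∷ xs) (b ∷ bs) = cong₂ _∷_ (cong (_, proj₂ x) (toℕ-fromℕ< b)) (map-toW-fromW xs bs)

  walk-fromW : ∀ ys → Walk _~_ (map toW ys) → Walk (Adj (lex (pathGraph m) H)) ys
  walk-fromW []           _            = tt
  walk-fromW (y ∷ [])     _            = tt
  walk-fromW (y ∷ z ∷ ys) (e , walk) = adj e , walk-fromW (z ∷ ys) walk
    where
    adj : toW y ~ toW z → Adj (lex (pathGraph m) H) y z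
    adj (inj₁ a)       = inj₁ a
    adj (inj₂ (e , a)) = inj₂ (toℕ-injective e , a)

  hamiltonianPath⇒HamPath : ∀ u v → HamiltonianPath (λ x → proj₁ x < m) (toW u) (toW v) →
                            ∃ λ p → HamPath (lex (pathGraph m) H) u v p
  hamiltonianPath⇒HamPath u v (hamiltonianPath (segment xs walk ends) unique sound complete)
    with All.tabulate sound
  ... | b ∷ bs = ys , ((λ ()) , walk-fromW ys (subst (Walk _~_) (sym ys≡) walk) , Unique.map⁻ (subst Unique (sym ys≡) unique)) ,
                 cover , cong just (toW-injective y≡) , trans (last-∷ y ys′) (cong just (toW-injective last≡))
    where
    y   = fromℕ< b , proj₂ u
    ys′ = fromW xs bs
    ys  = y ∷ ys′
    y≡ : toW y ≡ toW u
    y≡ = cong (_, proj₂ u) (toℕ-fromℕ< b)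
    ys≡ : map toW ys ≡ toW u ∷ xs
    ys≡ = cong₂ _∷_ y≡ (map-toW-fromW xs bs)
    cover : ∀ x → x ∈ ys
    cover x with ∈-map⁻ toW (subst (toW x ∈_) (sym ys≡) (complete (toℕ<n (proj₁ x))))
    ... | z , z∈ , e = subst (_∈ ys) (sym (toW-injective e)) z∈
    last≡ : toW (lastOr y ys′) ≡ toW v
    last≡ = begin
      toW (lastOr y ys′)           ≡⟨ sym (lastOr-map toW y ys′) ⟩
      lastOr (toW y) (map toW ys′) ≡⟨ cong₂ lastOr y≡ (map-toW-fromW xs bs) ⟩
      lastOr (toW u) xs            ≡⟨ ends ⟩
      toW v                        ∎
      where open ≡-Reasoning

  windowConnected⇒hamiltonianConnected : ∀ k → m ≡ 2 * k → Connectivity.WindowConnected H 0 k →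
                                         HamiltonianConnected (lex (pathGraph m) H)
  windowConnected⇒hamiltonianConnected k refl connected u v u≢v =
    hamiltonianPath⇒HamPath u v
      (HamiltonianPath-resp (proj₂ , (z≤n ,_))
        (connected (toW u) (toW v) (z≤n , toℕ<n (proj₁ u)) (z≤n , toℕ<n (proj₁ v)) (u≢v ∘ toW-injective)))

module ForestEdges {n : ℕ} (H : Graph (Fin n)) where

  open Constructions H

  forest-edge : ∀ ps → All (IsPath H) ps → 1 ≤ forestEdges ps →
                ∃₂ λ a b → Adj H a b × a ∈ concat ps × b ∈ concat ps
  forest-edge []                 []                        ()
  forest-edge ([] ∷ ps)          (_ ∷ paths)               e = forest-edge ps paths e
  forest-edge ((x ∷ []) ∷ ps)    (_ ∷ paths)               e with forest-edge ps paths e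
  ... | a , b , ab , a∈ , b∈ = a , b , ab , there a∈ , there b∈
  forest-edge ((x ∷ y ∷ _) ∷ ps) ((_ , (xy , _) , _) ∷ _) _ = x , y , xy , here refl , there (here refl)

  forest-twoEdges : ∀ ps → All (IsPath H) ps → Unique (concat ps) → 2 ≤ forestEdges ps → TwoEdges
  forest-twoEdges []                     []                 _ ()
  forest-twoEdges ([] ∷ ps)              (_ ∷ paths)        u e = forest-twoEdges ps paths u e
  forest-twoEdges ((x ∷ []) ∷ ps)        (_ ∷ paths) (_ ∷ u) e = forest-twoEdges ps paths u e
  forest-twoEdges ((x ∷ y ∷ z ∷ _) ∷ ps) ((_ , (xy , yz , _) , ((x≢y ∷ x≢z ∷ _) ∷ (y≢z ∷ _) ∷ _)) ∷ _) _ _ =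
    path₃ (unique₃ x≢y x≢z y≢z) xy yz
  forest-twoEdges ((x ∷ y ∷ []) ∷ ps)    ((_ , (xy , _) , _) ∷ paths) u (s≤s e) with forest-edge ps paths e
  ... | c , d , cd , c∈ , d∈ =
    matching ((adj⇒≢ xy ∷ x≢ (here refl) c∈ ∷ x≢ (here refl) d∈ ∷ []) ∷ (x≢ (there (here refl)) c∈ ∷ x≢ (there (here refl)) d∈ ∷ [])
              ∷ (adj⇒≢ cd ∷ []) ∷ [] ∷ [])
             xy cd
    where
    x≢ : ∀ {p q} → p ∈ x ∷ y ∷ [] → q ∈ concat ps → ¬ p ≡ q
    x≢ p∈ q∈ refl = Unique-++⇒disjoint (x ∷ y ∷ []) u p∈ q∈

module _ {n : ℕ} (H : Graph (Fin n)) where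

  open Connectivity H
  open ForestEdges H

  π≥1⇒hamiltonianConnected : πAtLeast H 1 → HamiltonianConnected (lex (pathGraph 2) H)
  π≥1⇒hamiltonianConnected (ps , (paths , _) , e) with forest-edge ps paths e
  ... | _ , _ , ab , _ = Transfer.windowConnected⇒hamiltonianConnected H 2 1 refl (window₁-connected ab 0)

  π≥2⇒hamiltonianConnected : ∀ {k} → 1 ≤ k → πAtLeast H 2 → HamiltonianConnected (lex (pathGraph (2 * k)) H)
  π≥2⇒hamiltonianConnected {k} k≥1 (ps , (paths , unique , _) , e) =
    Transfer.windowConnected⇒hamiltonianConnected H (2 * k) k refl (window-connected (forest-twoEdges ps paths unique e) k k≥1 0)

theorem9 : (k : ℕ) → 1 ≤ k → (n : ℕ) → 2 ≤ n → (H : Graph (Fin n)) →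
    (k ≡ 1 → (HamiltonianConnected (lex (pathGraph (2 * k)) H) ⇔ πAtLeast H 1)) ×
    (k > 1 → (HamiltonianConnected (lex (pathGraph (2 * k)) H) ⇔ πAtLeast H 2))
theorem9 k k≥1 n n≥2 H =
  (λ { refl → mk⇔ (hamiltonianConnected⇒π≥1 H (s≤s (s≤s z≤n)) n≥2) (π≥1⇒hamiltonianConnected H) }) ,
  (λ k>1 → mk⇔ (hamiltonianConnected⇒π≥2 H (+-mono-≤ k>1 (≤-trans k≥1 (m≤m+n k 0))) n≥2) (π≥2⇒hamiltonianConnected H k≥1))
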